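{- Let $n\ge r\ge 1$ be integers and let $G=V^1\vee V^2\vee\cdots\vee V^r$ be a join digraph of order $n$, where each $V^i$ is a weakly connected acyclic digraph on $n_i$ vertices, $n_1\ge\cdots\ge n_r\ge1$ and $\sum_{i=1}^r n_i=n$. Then: (i) $$LSM_3(G)\geq\sum_{i=1}^r\left[-n_i^4+(3n+6)n_i^3-(3n^2+12n+6)n_i^2+(n^3+6n^2+9n+4)n_i\right]-r(3n^2+3n+1)-\sum_{i=1}^rn_i\sum_{s\neq i}n_s(n-n_s-n_i),$$ with equality if and only if each $V^i$ is an in-tree. (ii) $$LSM_3(G)\leq\sum_{i=1}^r\left[-\frac{1}{4}n_i^4+\left(n+\frac{5}{2}\right)n_i^3-\left(\frac{3n^2}{2}+\frac{9n}{2}+\frac{1}{4}\right)n_i^2+\left(n^3+\frac{3n^2}{2}+\frac{n}{2}\right)n_i\right]-\sum_{i=1}^rn_i\sum_{s\neq i}n_s(n-n_s-n_i),$$ with equality if and only if each $V^i$ is a transitive tournament.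
   Context: All digraphs are finite, have no loops or multiple arcs, and are weakly connected (standing assumption). For a digraph $G$ with vertex set $\{v_1,\dots,v_n\}$, $d_i^+$ is the outdegree of $v_i$, $A(G)$ the adjacency matrix, $D^+(G)=\mathrm{diag}(d_1^+,\dots,d_n^+)$, and $L(G)=D^+(G)-A(G)$ the Laplacian matrix. For a nonnegative integer $k$, the $k$-th Laplacian spectral moment is $LSM_k(G)=\sum_{i=1}^n\lambda_i^k$, where $\lambda_i$ are the eigenvalues of $L(G)$ (so $LSM_3(G)=\mathrm{tr}(L(G)^3)$). A digraph is acyclic if it has no directed cycle. The join $G_1\vee G_2$ of vertex-disjoint digraphs has vertex set $\mathcal V(G_1)\cup\mathcal V(G_2)$ and arc set $\mathcal A(G_1)\cup\mathcal A(G_2)\cup\{(u,v),(v,u): u\in\mathcal V(G_1), v\in\mathcal V(G_2)\}$. An in-tree is a digraph whose underlying undirected graph is a tree and in which every vertex has outdegree at most one. A transitive tournament is an orientation of a complete graph such that $(u,v),(v,w)$ arcs imply $(u,w)$ is an arc. -}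

module Defs where

open import Data.Nat as ℕ using (ℕ; zero; suc)
open import Data.Integer as ℤ using (ℤ; +_; _+_; _-_; _*_)
open import Data.Fin using (Fin; zero; suc; splitAt; _≟_)
open import Data.Bool using (Bool; true; false; if_then_else_)
open import Data.Sum using (_⊎_; inj₁; inj₂)
open import Data.Product using (Σ; _×_; _,_; ∃-syntax)
open import Relation.Nullary using (¬_; yes; no; does)
open import Relation.Binary.PropositionalEquality using (_≡_; _≢_)
open import Function.Definitions using (Injective)

-- Digraphs on the vertex set Fin n, given by their arc indicator:
-- adj u v ≡ true  iff  (u , v) is an arc.

Digraph : ℕ → Set
Digraph n = Fin n → Fin n → Bool

Loopless : ∀ {n} → Digraph n → Set
Loopless {n} G = (v : Fin n) → G v v ≡ false

sumFin : (n : ℕ) → (Fin n → ℤ) → ℤ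
sumFin zero    f = + 0
sumFin (suc n) f = f zero + sumFin n (λ i → f (suc i))

[_] : Bool → ℤ
[ true ]  = + 1
[ false ] = + 0

outdeg : ∀ {n} → Digraph n → Fin n → ℤ
outdeg {n} G v = sumFin n (λ u → [ G v u ])

Laplacian : ∀ {n} → Digraph n → Fin n → Fin n → ℤ
Laplacian G i j with i ≟ j
... | yes _ = outdeg G i - [ G i j ]
... | no  _ = + 0 - [ G i j ]

-- LSM₃(G) = Σ λᵢ³ = tr(L(G)³)
LSM3 : ∀ {n} → Digraph n → ℤ
LSM3 {n} G =
  sumFin n λ i → sumFin n λ j → sumFin n λ k →
    L i j * L j k * L k i
  where L = Laplacian G

UAdj : ∀ {n} → Digraph n → Fin n → Fin n → Set
UAdj G u v = (G u v ≡ true) ⊎ (G v u ≡ true)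

data UReach {n} (G : Digraph n) : Fin n → Fin n → Set where
  here : ∀ {u} → UReach G u u
  step : ∀ {u v w} → UAdj G u v → UReach G v w → UReach G u w

WeaklyConnected : ∀ {n} → Digraph n → Set
WeaklyConnected {n} G = (u v : Fin n) → UReach G u v

data DWalk⁺ {n} (G : Digraph n) : Fin n → Fin n → Set where
  arc  : ∀ {u v} → G u v ≡ true → DWalk⁺ G u v
  _∷ₐ_ : ∀ {u v w} → G u v ≡ true → DWalk⁺ G v w → DWalk⁺ G u w

-- acyclic: no directed cycle (equivalently no closed directed walk)
Acyclic : ∀ {n} → Digraph n → Set
Acyclic {n} G = (v : Fin n) → ¬ DWalk⁺ G v v

-- a cycle in the underlying undirected graph: k+3 ≥ 3 distinct vertices
-- c 0, c 1, ..., c (k+2), consecutive ones adjacent, and c (k+2) adjacent to c 0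

sucMod : ∀ {m} → Fin (suc m) → Fin (suc m)
sucMod {zero}  zero    = zero
sucMod {suc m} zero    = suc zero
sucMod {suc m} (suc i) with sucMod {m} i
... | zero  = zero
... | suc j = suc (suc j)

HasUCycle : ∀ {n} → Digraph n → Set
HasUCycle {n} G =
  ∃[ k ] Σ (Fin (3 ℕ.+ k) → Fin n) λ c →
    Injective _≡_ _≡_ c × ((i : Fin (3 ℕ.+ k)) → UAdj G (c i) (c (sucMod i)))

UnderlyingTree : ∀ {n} → Digraph n → Set
UnderlyingTree G = WeaklyConnected G × ¬ HasUCycle G

InTree : ∀ {n} → Digraph n → Set
InTree {n} G = UnderlyingTree G × ((v : Fin n) → outdeg G v ℤ.≤ + 1)

TransitiveTournament : ∀ {n} → Digraph n → Set
TransitiveTournament {n} G =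
  ((u v : Fin n) → u ≢ v →
     ((G u v ≡ true) × (G v u ≡ false)) ⊎ ((G u v ≡ false) × (G v u ≡ true)))
  × ((u v w : Fin n) → G u v ≡ true → G v w ≡ true → G u w ≡ true)

join : ∀ {m n} → Digraph m → Digraph n → Digraph (m ℕ.+ n)
join {m} G H x y with splitAt m x | splitAt m y
... | inj₁ a | inj₁ b = G a b
... | inj₂ a | inj₂ b = H a b
... | inj₁ _ | inj₂ _ = true
... | inj₂ _ | inj₁ _ = true

total : (r : ℕ) → (Fin r → ℕ) → ℕ
total zero    ns = 0
total (suc r) ns = ns zero ℕ.+ total r (λ i → ns (suc i))

-- V¹ ∨ V² ∨ ⋯ ∨ V^r  (the r = 0 case is the empty digraph, the unit of ∨)
joinAll : (r : ℕ) (ns : Fin r → ℕ) → ((i : Fin r) → Digraph (ns i)) →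
          Digraph (total r ns)
joinAll zero    ns Vs ()
joinAll (suc r) ns Vs = join (Vs zero) (joinAll r (λ i → ns (suc i)) (λ i → Vs (suc i)))

crossTerm : (r : ℕ) → (Fin r → ℕ) → ℤ
crossTerm r ns =
  sumFin r λ i → + ns i * sumFin r λ s →
    (if does (s ≟ i) then + 0 else + ns s * (+ total r ns - + ns s - + ns i))

lowerBound : (r : ℕ) → (Fin r → ℕ) → ℤ
lowerBound r ns =
  sumFin r (λ i → let a = + ns i in
      ℤ.- (a ℤ.^ 4) + (+ 3 * n + + 6) * a ℤ.^ 3
      - (+ 3 * n ℤ.^ 2 + + 12 * n + + 6) * a ℤ.^ 2
      + (n ℤ.^ 3 + + 6 * n ℤ.^ 2 + + 9 * n + + 4) * a)
  - + r * (+ 3 * n ℤ.^ 2 + + 3 * n + + 1)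
  - crossTerm r ns
  where n = + total r ns

-- 4 × (right-hand side of (ii)), cleared of denominators
upperBound×4 : (r : ℕ) → (Fin r → ℕ) → ℤ
upperBound×4 r ns =
  sumFin r (λ i → let a = + ns i in
      ℤ.- (a ℤ.^ 4) + (+ 4 * n + + 10) * a ℤ.^ 3
      - (+ 6 * n ℤ.^ 2 + + 18 * n + + 1) * a ℤ.^ 2
      + (+ 4 * n ℤ.^ 3 + + 6 * n ℤ.^ 2 + + 2 * n) * a)
  - + 4 * crossTerm r ns
  where n = + total r ns

-- Put Nᵢ = n − nᵢ. In the join, a vertex v of Vⁱ has outdegree d(v) + Nᵢ and lies on Nᵢ
-- directed 2-cycles, while tr L³ = Σ_v (d_v³ + 3 d_v c_v) − tr A³ with c_v the number of
-- 2-cycles through v. Summing over the parts, LSM₃(G) = Σᵢ Σ_{v ∈ Vⁱ} f_{Nᵢ}(d(v)) + C, where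
-- f_N(d) = (N + d)³ − N³ and C, the value for arcless parts, depends only on n₁, …, n_r.
-- For an acyclic part it remains to bound Σ_v f_N(d(v)). From below: f_N(d) ≥ d f_N(1), and a
-- weakly connected digraph has at least nᵢ − 1 arcs; equality forces all outdegrees ≤ 1, that is,
-- an in-tree. From above: deleting a sink lowers the other outdegrees by at most one, so the sum
-- is at most f_N(0) + ⋯ + f_N(nᵢ − 1), with equality iff every deleted sink receives an arc from
-- each remaining vertex, that is, a transitive tournament.

module Submission where

open import Defs
module OutdegreeBounds where
  open import Data.Nat using (ℕ; zero; suc; _+_; _*_; _∸_; _≤_; _<_; z≤n; s≤s)
  open import Data.Nat.Properties hiding (_≟_)
  open import Data.Nat.Tactic.RingSolver using (solve-∀)
  open import Algebra.Properties.Semiring.Sum +-*-semiring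
    using (sum; sum-cong-≗; sum-replicate-zero; ∑-distrib-+; *-distribʳ-sum)
  open import Data.Fin using (Fin; zero; suc; _≟_; toℕ)
  import Data.Fin.Properties as Fin
  open import Data.Bool using (Bool; true; false; _∧_; _∨_; not; if_then_else_)
  open import Data.Bool.Properties using (∧-identityʳ; ∧-zeroʳ; ∨-identityʳ; ∨-zeroʳ)
  import Data.Bool as Bool
  open import Data.Unit using (⊤; tt)
  open import Data.Empty using (⊥; ⊥-elim)
  open import Data.Product using (Σ; ∃; _×_; _,_; proj₁; proj₂)
  open import Data.Sum using (_⊎_; inj₁; inj₂)
  open import Relation.Nullary using (¬_; Dec; yes; no; does)
  open import Relation.Nullary.Decidable using (_×-dec_; _→-dec_)
  open import Relation.Binary.PropositionalEquality
  open import Relation.Binary.Definitions using (tri<; tri≈; tri>)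
  open import Relation.Binary.Core using (_Preserves_⟶_)
  open import Function using (_$_; _∘_)
  open import Function.Bundles using (_⇔_; mk⇔; Equivalence)

  sum-mono : ∀ {n} {f g : Fin n → ℕ} → (∀ i → f i ≤ g i) → sum f ≤ sum g
  sum-mono {zero}  le = z≤n
  sum-mono {suc n} le = +-mono-≤ (le zero) (sum-mono (λ i → le (suc i)))

  sum-zero : ∀ {n} {f : Fin n → ℕ} → (∀ i → f i ≡ 0) → sum f ≡ 0
  sum-zero {n} f≗0 = trans (sum-cong-≗ f≗0) (sum-replicate-zero n)

  +-mono-≡ : ∀ {a b c d} → a ≤ b → c ≤ d → a + c ≡ b + d → a ≡ b × c ≡ d
  +-mono-≡ {a} {b} {c} {d} a≤b c≤d eq = a≡b , +-cancelˡ-≡ a c d (trans eq (cong (_+ d) (sym a≡b)))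
    where
      a≡b : a ≡ b
      a≡b = ≤-antisym a≤b (+-cancelʳ-≤ d b a (≤-trans (≤-reflexive (sym eq)) (+-monoʳ-≤ a c≤d)))

  sum-mono-≡ : ∀ {n} {f g : Fin n → ℕ} → (∀ i → f i ≤ g i) → sum f ≡ sum g → ∀ i → f i ≡ g i
  sum-mono-≡ {suc n} le eq i
    with +-mono-≡ (le zero) (sum-mono (λ i → le (suc i))) eq
  sum-mono-≡ {suc n} le eq zero    | head , _ = head
  sum-mono-≡ {suc n} le eq (suc i) | _ , tail = sum-mono-≡ (λ i → le (suc i)) tail i

  sum-ones : ∀ n → sum {n} (λ _ → 1) ≡ n
  sum-ones zero    = refl
  sum-ones (suc n) = cong suc (sum-ones n)

  sum-extract : ∀ {n} (s : Fin n) (f : Fin n → ℕ) →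
                sum f ≡ f s + sum (λ v → if does (v ≟ s) then 0 else f v)
  sum-extract zero    f = refl
  sum-extract (suc s) f =
    trans (cong (f zero +_) (sum-extract s (λ i → f (suc i)))) (+-left-comm (f zero) (f (suc s)) _)
    where
      +-left-comm : ∀ a b c → a + (b + c) ≡ b + (a + c)
      +-left-comm = solve-∀

  false≢true : false ≢ true
  false≢true ()

  VertexSet : ℕ → Set
  VertexSet m = Fin m → Bool

  module _ {m : ℕ} where
    sumOver : VertexSet m → (Fin m → ℕ) → ℕ
    sumOver S h = sum (λ v → if S v then h v else 0)

    size : VertexSet m → ℕ
    size S = sumOver S (λ _ → 1)

    full : VertexSet m
    full _ = true

    remove : VertexSet m → Fin m → VertexSet m
    remove S s v = S v ∧ not (does (v ≟ s))

    insert : VertexSet m → Fin m → VertexSet m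
    insert S w v = S v ∨ does (v ≟ w)

    sumOver-extract : ∀ S {s} h → S s ≡ true → sumOver S h ≡ h s + sumOver (remove S s) h
    sumOver-extract S {s} h s∈S =
      trans (sum-extract s _) (cong₂ _+_ (cong (if_then h s else 0) s∈S) (sum-cong-≗ mask))
      where
        mask : ∀ v → (if does (v ≟ s) then 0 else (if S v then h v else 0))
                     ≡ (if remove S s v then h v else 0)
        mask v with does (v ≟ s) | S v
        ... | true  | true  = refl
        ... | true  | false = refl
        ... | false | true  = refl
        ... | false | false = refl

    sumOver-congˡ : ∀ {S S'} h → (∀ v → S v ≡ S' v) → sumOver S h ≡ sumOver S' h
    sumOver-congˡ h S≗S' = sum-cong-≗ (λ v → cong (if_then h v else 0) (S≗S' v))

    sumOver-congʳ : ∀ S {h h'} → (∀ v → S v ≡ true → h v ≡ h' v) → sumOver S h ≡ sumOver S h'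
    sumOver-congʳ S {h} {h'} h≗h' = sum-cong-≗ pointwise
      where
        pointwise : ∀ v → (if S v then h v else 0) ≡ (if S v then h' v else 0)
        pointwise v with S v in v∈S
        ... | true  = h≗h' v v∈S
        ... | false = refl

    private
      if-mono : ∀ (S : VertexSet m) {h h' : Fin m → ℕ} → (∀ v → S v ≡ true → h v ≤ h' v) →
                ∀ v → (if S v then h v else 0) ≤ (if S v then h' v else 0)
      if-mono S le v with S v in v∈S
      ... | true  = le v v∈S
      ... | false = z≤n

    sumOver-mono : ∀ S {h h'} → (∀ v → S v ≡ true → h v ≤ h' v) → sumOver S h ≤ sumOver S h'
    sumOver-mono S le = sum-mono (if-mono S le)

    sumOver-mono-≡ : ∀ S {h h'} → (∀ v → S v ≡ true → h v ≤ h' v) → sumOver S h ≡ sumOver S h' →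
                     ∀ v → S v ≡ true → h v ≡ h' v
    sumOver-mono-≡ S {h} {h'} le eq v v∈S =
      subst (λ b → (if b then h v else 0) ≡ (if b then h' v else 0)) v∈S (sum-mono-≡ (if-mono S le) eq v)

    sumOver-≤-sum : ∀ S h → sumOver S h ≤ sum h
    sumOver-≤-sum S h = sum-mono pointwise
      where
        pointwise : ∀ v → (if S v then h v else 0) ≤ h v
        pointwise v with S v
        ... | true  = ≤-refl
        ... | false = z≤n

    member-≤-sumOver : ∀ S h {v} → S v ≡ true → h v ≤ sumOver S h
    member-≤-sumOver S h {v} v∈S = subst (h v ≤_) (sym (sumOver-extract S h v∈S)) (m≤m+n (h v) _)

    sumOver-zero : ∀ S h → (∀ v → S v ≡ true → h v ≡ 0) → sumOver S h ≡ 0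
    sumOver-zero S h h≗0 = trans (sumOver-congʳ S h≗0) (sum-zero pointwise)
      where
        pointwise : ∀ v → (if S v then 0 else 0) ≡ 0
        pointwise v with S v
        ... | true  = refl
        ... | false = refl

    sumOver-+ : ∀ S f g → sumOver S (λ v → f v + g v) ≡ sumOver S f + sumOver S g
    sumOver-+ S f g = trans (sum-cong-≗ pointwise) (∑-distrib-+ (λ v → if S v then f v else 0) _)
      where
        pointwise : ∀ v → (if S v then f v + g v else 0) ≡ (if S v then f v else 0) + (if S v then g v else 0)
        pointwise v with S v
        ... | true  = refl
        ... | false = refl

    size-full : size full ≡ m
    size-full = sum-ones m

    size≡0⇒∉ : ∀ S → size S ≡ 0 → ∀ {v} → S v ≡ true → ⊥
    size≡0⇒∉ S empty v∈S = 1+n≰n (subst (1 ≤_) empty (member-≤-sumOver S (λ _ → 1) v∈S))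

    ∈-remove : ∀ S {s v} → S v ≡ true → v ≢ s → remove S s v ≡ true
    ∈-remove S {s} {v} v∈S v≢s with v ≟ s
    ... | yes v≡s = ⊥-elim (v≢s v≡s)
    ... | no _    = trans (∧-identityʳ (S v)) v∈S

    remove-⊆ : ∀ S {s v} → remove S s v ≡ true → S v ≡ true
    remove-⊆ S {s} {v} v∈S' with S v
    ... | true  = refl
    ... | false = v∈S'

    remove-≢ : ∀ S {s v} → remove S s v ≡ true → v ≢ s
    remove-≢ S {s} {v} v∈S' v≡s with v ≟ s
    ... | yes _  = false≢true (trans (sym (∧-zeroʳ (S v))) v∈S')
    ... | no v≢s = v≢s v≡s

    remove-insert : ∀ S {w} → S w ≡ false → ∀ v → remove (insert S w) w v ≡ S v
    remove-insert S {w} w∉S v with v ≟ w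
    ... | yes refl = trans (∧-zeroʳ _) (sym w∉S)
    ... | no _     = trans (∧-identityʳ _) (∨-identityʳ (S v))

    ∈-insert : ∀ S w → insert S w w ≡ true
    ∈-insert S w with w ≟ w
    ... | yes _  = ∨-zeroʳ (S w)
    ... | no w≢w = ⊥-elim (w≢w refl)

    insert-⊇ : ∀ S w {v} → S v ≡ true → insert S w v ≡ true
    insert-⊇ S w v∈S rewrite v∈S = refl

    sumOver-insert : ∀ S {w} h → S w ≡ false → sumOver (insert S w) h ≡ h w + sumOver S h
    sumOver-insert S {w} h w∉S =
      trans (sumOver-extract (insert S w) h (∈-insert S w)) (cong (h w +_) (sumOver-congˡ h (remove-insert S w∉S)))

  [_]ℕ : Bool → ℕ
  [ true ]ℕ  = 1
  [ false ]ℕ = 0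

  [_]ℕ≤1 : ∀ b → [ b ]ℕ ≤ 1
  [ true ]ℕ≤1  = s≤s z≤n
  [ false ]ℕ≤1 = z≤n

  [_]ℕ≡1 : ∀ {b} → [ b ]ℕ ≡ 1 → b ≡ true
  [_]ℕ≡1 {true} _ = refl

  module _ {m : ℕ} where
    open import Function.Endo.Propositional (Fin m) using (_^_; ^-homo)

    _∷ʳ_ : {G : Digraph m} {u v w : Fin m} → DWalk⁺ G u v → G v w ≡ true → DWalk⁺ G u w
    arc uv      ∷ʳ vw = uv ∷ₐ arc vw
    (uv ∷ₐ walk) ∷ʳ vw = uv ∷ₐ (walk ∷ʳ vw)

    reverse : Digraph m → Digraph m
    reverse G u v = G v u

    acyclic-reverse : ∀ {G} → Acyclic G → Acyclic (reverse G)
    acyclic-reverse {G} acyclic v walk = acyclic v (backwards walk)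
      where
        backwards : ∀ {u w} → DWalk⁺ (reverse G) u w → DWalk⁺ G w u
        backwards (arc uw)     = arc uw
        backwards (uv ∷ₐ walk) = backwards walk ∷ʳ uv

    acyclic-pullback : ∀ {p G} (c : Fin p → Fin m) → Acyclic G → Acyclic (λ i j → G (c i) (c j))
    acyclic-pullback {G = G} c acyclic i walk = acyclic (c i) (image walk)
      where
        image : ∀ {i j} → DWalk⁺ (λ i j → G (c i) (c j)) i j → DWalk⁺ G (c i) (c j)
        image (arc ij)     = arc ij
        image (ij ∷ₐ walk) = ij ∷ₐ image walk

    -- Iterating a successor map from x must revisit a vertex, by pigeonhole.
    acyclic-successor-⊥ : ∀ {G} → Acyclic G → (next : Fin m → Fin m) (Q : Fin m → Set) →
                          (∀ y → Q y → Q (next y)) → (∀ y → Q y → G y (next y) ≡ true) →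
                          ∀ {x} → Q x → ⊥
    acyclic-successor-⊥ {G} acyclic next Q closed forward {x} x∈Q
      with Fin.pigeonhole (n<1+n m) (λ i → (next ^ toℕ i) x)
    ... | i , j , i<j , meet = acyclic y (subst (DWalk⁺ G y) returns (walk (iterate-∈ x∈Q (toℕ i)) d))
      where
        iterate-∈ : ∀ {y} → Q y → ∀ k → Q ((next ^ k) y)
        iterate-∈ y∈Q zero    = y∈Q
        iterate-∈ y∈Q (suc k) = closed _ (iterate-∈ y∈Q k)
        walk : ∀ {y} → Q y → ∀ d → DWalk⁺ G y ((next ^ suc d) y)
        walk y∈Q zero    = arc (forward _ y∈Q)
        walk y∈Q (suc d) = walk y∈Q d ∷ʳ forward _ (iterate-∈ y∈Q (suc d))
        y : Fin m
        y = (next ^ toℕ i) x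
        d : ℕ
        d = toℕ j ∸ suc (toℕ i)
        returns : (next ^ suc d) y ≡ y
        returns = begin
          (next ^ suc d) ((next ^ toℕ i) x) ≡⟨ cong-app (^-homo next (suc d) (toℕ i)) x ⟨
          (next ^ (suc d + toℕ i)) x         ≡⟨ cong (λ k → (next ^ k) x) (trans (sym (+-suc d (toℕ i))) (m∸n+n≡m i<j)) ⟩
          (next ^ toℕ j) x                   ≡⟨ meet ⟨
          y                                  ∎
          where open ≡-Reasoning

  ≢true⇒≡false : ∀ {b} → b ≢ true → b ≡ false
  ≢true⇒≡false {true}  b≢true = ⊥-elim (b≢true refl)
  ≢true⇒≡false {false} _      = refl

  ≢false⇒≡true : ∀ {b} → b ≢ false → b ≡ true
  ≢false⇒≡true {true}  _       = refl
  ≢false⇒≡true {false} b≢false = ⊥-elim (b≢false refl)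

  size≢0⇒nonempty : ∀ {m} (S : VertexSet m) → size S ≢ 0 → ∃ λ v → S v ≡ true
  size≢0⇒nonempty S size≢0 with Fin.any? (λ v → S v Bool.≟ true)
  ... | yes nonempty = nonempty
  ... | no  empty    = ⊥-elim (size≢0 (sumOver-zero S _ (λ v v∈S → ⊥-elim (empty (v , v∈S)))))

  sumBelow : ℕ → (ℕ → ℕ) → ℕ
  sumBelow zero    g = 0
  sumBelow (suc k) g = g 0 + sumBelow k (λ j → g (suc j))

  sumBelow-last : ∀ k g → sumBelow (suc k) g ≡ sumBelow k g + g k
  sumBelow-last zero    g = +-comm (g 0) 0
  sumBelow-last (suc k) g =
    trans (cong (g 0 +_) (sumBelow-last k (λ j → g (suc j)))) (sym (+-assoc (g 0) _ _))

  strict⇒monotone : ∀ {g} → g Preserves _<_ ⟶ _<_ → g Preserves _≤_ ⟶ _≤_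
  strict⇒monotone g-strict a≤b with m≤n⇒m<n∨m≡n a≤b
  ... | inj₁ a<b  = <⇒≤ (g-strict a<b)
  ... | inj₂ refl = ≤-refl

  strict⇒injective : ∀ {g} → g Preserves _<_ ⟶ _<_ → ∀ {a b} → g a ≡ g b → a ≡ b
  strict⇒injective g-strict {a} {b} ga≡gb with <-cmp a b
  ... | tri< a<b _ _ = ⊥-elim (<-irrefl ga≡gb (g-strict a<b))
  ... | tri≈ _ a≡b _ = a≡b
  ... | tri> _ _ b<a = ⊥-elim (<-irrefl (sym ga≡gb) (g-strict b<a))

  module _ {m : ℕ} (G : Digraph m) where
    outdegIn : VertexSet m → Fin m → ℕ
    outdegIn S v = sumOver S (λ u → [ G v u ]ℕ)

    outdegℕ : Fin m → ℕ
    outdegℕ = outdegIn full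

    IsSink : VertexSet m → Fin m → Set
    IsSink S s = S s ≡ true × (∀ {u} → S u ≡ true → G s u ≡ false)

    sink-exists : Acyclic G → ∀ S {v} → S v ≡ true → ∃ (IsSink S)
    sink-exists acyclic S {v} v∈S
      with Fin.any? (λ s → (S s Bool.≟ true) ×-dec Fin.all? (λ u → (S u Bool.≟ true) →-dec (G s u Bool.≟ false)))
    ... | yes (s , s∈S , sink) = s , s∈S , λ {u} → sink u
    ... | no  no-sink = ⊥-elim $
      acyclic-successor-⊥ acyclic next (λ y → S y ≡ true)
        (λ y y∈S → proj₁ (next-spec y y∈S)) (λ y y∈S → proj₂ (next-spec y y∈S)) v∈S
      where
        OutNeighbourIn : Fin m → Set
        OutNeighbourIn y = ∃ λ u → S u ≡ true × G y u ≡ true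
        pick : ∀ y → Dec (OutNeighbourIn y) → Fin m
        pick y (yes (u , _)) = u
        pick y (no _)        = y
        pick-spec : ∀ y d → S y ≡ true → S (pick y d) ≡ true × G y (pick y d) ≡ true
        pick-spec y (yes (u , spec)) _   = spec
        pick-spec y (no none)        y∈S =
          ⊥-elim (no-sink (y , y∈S , λ u u∈S → ≢true⇒≡false (λ yu → none (u , u∈S , yu))))
        out? : ∀ y → Dec (OutNeighbourIn y)
        out? y = Fin.any? (λ u → (S u Bool.≟ true) ×-dec (G y u Bool.≟ true))
        next : Fin m → Fin m
        next y = pick y (out? y)
        next-spec : ∀ y → S y ≡ true → S (next y) ≡ true × G y (next y) ≡ true
        next-spec y = pick-spec y (out? y)

    TournamentOn : VertexSet m → Set
    TournamentOn S =
      (∀ {u v} → S u ≡ true → S v ≡ true → u ≢ v →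
         ((G u v ≡ true) × (G v u ≡ false)) ⊎ ((G u v ≡ false) × (G v u ≡ true)))
      × (∀ {u v w} → S u ≡ true → S v ≡ true → S w ≡ true → G u v ≡ true → G v w ≡ true → G u w ≡ true)

    outdegIn-sink : ∀ {S s} → IsSink S s → outdegIn S s ≡ 0
    outdegIn-sink {S} (_ , sink) = sumOver-zero S _ (λ u u∈S → cong [_]ℕ (sink u∈S))

    outdegIn-remove : ∀ S {s} → S s ≡ true → ∀ v → outdegIn S v ≡ [ G v s ]ℕ + outdegIn (remove S s) v
    outdegIn-remove S s∈S v = sumOver-extract S _ s∈S

    module _ {S : VertexSet m} {s : Fin m} (sink : IsSink S s) where
      private
        S' : VertexSet m
        S' = remove S s

      tournament-remove : TournamentOn S → TournamentOn S'
      tournament-remove (complete , transitive) =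
        (λ u∈ v∈ → complete (remove-⊆ S u∈) (remove-⊆ S v∈))
        , (λ u∈ v∈ w∈ → transitive (remove-⊆ S u∈) (remove-⊆ S v∈) (remove-⊆ S w∈))

      tournament-arc-to-sink : TournamentOn S → ∀ {v} → S' v ≡ true → G v s ≡ true
      tournament-arc-to-sink (complete , _) v∈S'
        with complete (remove-⊆ S v∈S') (proj₁ sink) (remove-≢ S v∈S')
      ... | inj₁ (vs , _) = vs
      ... | inj₂ (_ , sv) = ⊥-elim (false≢true (trans (sym (proj₂ sink (remove-⊆ S v∈S'))) sv))

      tournament-add-sink : TournamentOn S' → (∀ {v} → S' v ≡ true → G v s ≡ true) → TournamentOn S
      tournament-add-sink (complete , transitive) to-sink = complete′ , transitive′
        where
          S'∋ : ∀ {x} → S x ≡ true → x ≢ s → S' x ≡ true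
          S'∋ x∈S x≢s = ∈-remove S x∈S x≢s
          complete′ : ∀ {u v} → S u ≡ true → S v ≡ true → u ≢ v →
                      ((G u v ≡ true) × (G v u ≡ false)) ⊎ ((G u v ≡ false) × (G v u ≡ true))
          complete′ {u} {v} u∈ v∈ u≢v with u ≟ s | v ≟ s
          ... | yes refl | yes refl = ⊥-elim (u≢v refl)
          ... | yes refl | no v≢s   = inj₂ (proj₂ sink v∈ , to-sink (S'∋ v∈ v≢s))
          ... | no u≢s   | yes refl = inj₁ (to-sink (S'∋ u∈ u≢s) , proj₂ sink u∈)
          ... | no u≢s   | no v≢s   = complete (S'∋ u∈ u≢s) (S'∋ v∈ v≢s) u≢v
          transitive′ : ∀ {u v w} → S u ≡ true → S v ≡ true → S w ≡ true →
                        G u v ≡ true → G v w ≡ true → G u w ≡ true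
          transitive′ {u} {v} {w} u∈ v∈ w∈ uv vw with u ≟ s | v ≟ s | w ≟ s
          ... | yes refl | _        | _        = ⊥-elim (false≢true (trans (sym (proj₂ sink v∈)) uv))
          ... | no _     | yes refl | _        = ⊥-elim (false≢true (trans (sym (proj₂ sink w∈)) vw))
          ... | no u≢s   | no _     | yes refl = to-sink (S'∋ u∈ u≢s)
          ... | no u≢s   | no v≢s   | no w≢s   =
            transitive (S'∋ u∈ u≢s) (S'∋ v∈ v≢s) (S'∋ w∈ w≢s) uv vw

      sumOver-remove-sink : ∀ (g : ℕ → ℕ) → sumOver S (λ v → g (outdegIn S v)) ≡ g 0 + sumOver S' (λ v → g (outdegIn S v))
      sumOver-remove-sink g =
        trans (sumOver-extract S (λ v → g (outdegIn S v)) (proj₁ sink))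
              (cong (λ d → g d + sumOver S' (λ v → g (outdegIn S v))) (outdegIn-sink sink))

      module _ {g : ℕ → ℕ} (g-strict : g Preserves _<_ ⟶ _<_) where
        private
          pointwise : ∀ v → S' v ≡ true → g (outdegIn S v) ≤ g (suc (outdegIn S' v))
          pointwise v _ = strict⇒monotone g-strict
            (subst (_≤ suc (outdegIn S' v)) (sym (outdegIn-remove S (proj₁ sink) v))
              (+-monoˡ-≤ (outdegIn S' v) ([ G v s ]ℕ≤1)))

        -- Removing a sink lowers each remaining outdegree by at most one, and by exactly one
        -- for all of them iff every remaining vertex points to the sink.
        sumOver-remove-sink-≤ : sumOver S' (λ v → g (outdegIn S v)) ≤ sumOver S' (λ v → g (suc (outdegIn S' v)))
        sumOver-remove-sink-≤ = sumOver-mono S' pointwise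

        sumOver-remove-sink-≡⇔ : sumOver S' (λ v → g (outdegIn S v)) ≡ sumOver S' (λ v → g (suc (outdegIn S' v)))
                                 ⇔ (∀ {v} → S' v ≡ true → G v s ≡ true)
        sumOver-remove-sink-≡⇔ = mk⇔
          (λ eq {v} v∈S' → [_]ℕ≡1 (+-cancelʳ-≡ (outdegIn S' v) [ G v s ]ℕ 1
            (trans (sym (outdegIn-remove S (proj₁ sink) v)) (strict⇒injective g-strict (sumOver-mono-≡ S' pointwise eq v v∈S')))))
          (λ to-sink → sumOver-congʳ S' (λ v v∈S' →
            cong g (trans (outdegIn-remove S (proj₁ sink) v) (cong (λ b → [ b ]ℕ + outdegIn S' v) (to-sink v∈S')))))

    outdeg-sum-≤-sumBelow : Acyclic G → ∀ k S → size S ≡ k → (g : ℕ → ℕ) → g Preserves _<_ ⟶ _<_ →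
      sumOver S (λ v → g (outdegIn S v)) ≤ sumBelow k g
      × (sumOver S (λ v → g (outdegIn S v)) ≡ sumBelow k g ⇔ TournamentOn S)
    outdeg-sum-≤-sumBelow acyclic zero S empty g g-strict =
      ≤-reflexive Σg≡0
      , mk⇔ (λ _ → (λ {_} {_} u∈ → ⊥-elim (∉ u∈)) , (λ {_} {_} {_} u∈ → ⊥-elim (∉ u∈))) (λ _ → Σg≡0)
      where
        ∉ : ∀ {v} → S v ≡ true → ⊥
        ∉ = size≡0⇒∉ S empty
        Σg≡0 : sumOver S (λ v → g (outdegIn S v)) ≡ 0
        Σg≡0 = sumOver-zero S _ (λ v v∈S → ⊥-elim (∉ v∈S))
    outdeg-sum-≤-sumBelow acyclic (suc k) S size≡ g g-strict = bound , mk⇔ to from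
      where
        nonempty : ∃ λ v → S v ≡ true
        nonempty = size≢0⇒nonempty S (λ size≡0 → 1+n≢0 (trans (sym size≡) size≡0))
        s : Fin m
        s = proj₁ (sink-exists acyclic S (proj₂ nonempty))
        sink : IsSink S s
        sink = proj₂ (sink-exists acyclic S (proj₂ nonempty))
        S' : VertexSet m
        S' = remove S s
        IH : sumOver S' (λ v → g (suc (outdegIn S' v))) ≤ sumBelow k (λ j → g (suc j))
             × (sumOver S' (λ v → g (suc (outdegIn S' v))) ≡ sumBelow k (λ j → g (suc j)) ⇔ TournamentOn S')
        IH = outdeg-sum-≤-sumBelow acyclic k S' (suc-injective (trans (sym (sumOver-extract S _ (proj₁ sink))) size≡))
               (λ j → g (suc j)) (λ j<j' → g-strict (s≤s j<j'))
        X Y : ℕ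
        X = sumOver S' (λ v → g (outdegIn S v))
        Y = sumOver S' (λ v → g (suc (outdegIn S' v)))
        bound : sumOver S (λ v → g (outdegIn S v)) ≤ sumBelow (suc k) g
        bound = subst (_≤ sumBelow (suc k) g) (sym (sumOver-remove-sink sink g))
                  (+-monoʳ-≤ (g 0) (≤-trans (sumOver-remove-sink-≤ sink g-strict) (proj₁ IH)))
        to : sumOver S (λ v → g (outdegIn S v)) ≡ sumBelow (suc k) g → TournamentOn S
        to tight = tournament-add-sink sink (Equivalence.to (proj₂ IH) (trans (sym X≡Y) X≡R))
                     (Equivalence.to (sumOver-remove-sink-≡⇔ sink g-strict) X≡Y)
          where
            X≡R : X ≡ sumBelow k (λ j → g (suc j))
            X≡R = +-cancelˡ-≡ (g 0) X _ (trans (sym (sumOver-remove-sink sink g)) tight)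
            X≡Y : X ≡ Y
            X≡Y = ≤-antisym (sumOver-remove-sink-≤ sink g-strict) (subst (Y ≤_) (sym X≡R) (proj₁ IH))
        from : TournamentOn S → sumOver S (λ v → g (outdegIn S v)) ≡ sumBelow (suc k) g
        from tournament = trans (sumOver-remove-sink sink g) (cong (g 0 +_)
          (trans (Equivalence.from (sumOver-remove-sink-≡⇔ sink g-strict) (tournament-arc-to-sink sink tournament))
                 (Equivalence.from (proj₂ IH) (tournament-remove sink tournament))))

  toℕ-sucMod : ∀ {m} (i : Fin (suc m)) →
               (toℕ i ≡ m × toℕ (sucMod i) ≡ 0) ⊎ (toℕ i < m × toℕ (sucMod i) ≡ suc (toℕ i))
  toℕ-sucMod {zero}  zero    = inj₁ (refl , refl)
  toℕ-sucMod {suc m} zero    = inj₂ (s≤s z≤n , refl)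
  toℕ-sucMod {suc m} (suc i) with sucMod {m} i | toℕ-sucMod {m} i
  ... | zero  | inj₁ (last , _)  = inj₁ (cong suc last , refl)
  ... | suc j | inj₂ (i<m , next) = inj₂ (s≤s i<m , cong suc next)

  suc-∸1 : ∀ {m} → Fin m → suc (m ∸ 1) ≡ m
  suc-∸1 {suc m} _ = refl

  n≢2+n : ∀ {n : ℕ} → n ≢ suc (suc n)
  n≢2+n ()

  sucMod²-≢ : ∀ k (i : Fin (3 + k)) → i ≢ sucMod (sucMod i)
  sucMod²-≢ k i i≡ with toℕ-sucMod i | toℕ-sucMod (sucMod i)
  ... | inj₁ (_ , to0)      | inj₁ (last , _)   = 0≢1+n (trans (sym to0) last)
  ... | inj₁ (last , to0)   | inj₂ (_ , to1)    = 0≢1+n (suc-injective (trans (sym (trans to1 (cong suc to0)))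
                                                    (trans (cong toℕ (sym i≡)) last)))
  ... | inj₂ (_ , succ)     | inj₁ (last , to0) = 0≢1+n (suc-injective (trans (sym (trans succ
                                                    (cong suc (trans (cong toℕ i≡) to0)))) last))
  ... | inj₂ (_ , succ)     | inj₂ (_ , succ²)  = n≢2+n (trans (cong toℕ i≡) (trans succ² (cong suc succ)))

  module _ {m : ℕ} (G : Digraph m) where
    two-out-neighbours : ∀ {v a b} → G v a ≡ true → G v b ≡ true → a ≢ b → 2 ≤ outdegℕ G v
    two-out-neighbours {v} {a} {b} va vb a≢b =
      subst (2 ≤_) (sym (outdegIn-remove G full refl v))
        (subst (λ x → 2 ≤ [ x ]ℕ + outdegIn G (remove full a) v) (sym va)
          (s≤s (subst (λ x → [ x ]ℕ ≤ outdegIn G (remove full a) v) vb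
                 (member-≤-sumOver (remove full a) (λ u → [ G v u ]ℕ) (∈-remove full refl (a≢b ∘ sym))))))

    -- Outdegree ≤ 1 forces an undirected cycle to be oriented consistently,
    -- making it a directed cycle.
    acyclic-outdeg≤1⇒¬HasUCycle : Acyclic G → (∀ v → outdegℕ G v ≤ 1) → ¬ HasUCycle G
    acyclic-outdeg≤1⇒¬HasUCycle acyclic outdeg≤1 (k , c , c-injective , adjacent)
      with Fin.any? (λ i → G (c (sucMod i)) (c i) Bool.≟ true)
    ... | yes (i , back) =
      acyclic-successor-⊥ (acyclic-pullback c (acyclic-reverse acyclic)) sucMod Backward backward-closed
        (λ _ back → back) back
      where
        Backward : Fin (3 + k) → Set
        Backward i = G (c (sucMod i)) (c i) ≡ true
        backward-closed : ∀ i → Backward i → Backward (sucMod i)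
        backward-closed i back with adjacent (sucMod i)
        ... | inj₂ back′   = back′
        ... | inj₁ forward = ⊥-elim (<-irrefl refl (≤-trans
                (two-out-neighbours back forward (λ eq → sucMod²-≢ k i (c-injective eq))) (outdeg≤1 _)))
    ... | no no-back =
      acyclic-successor-⊥ (acyclic-pullback c acyclic) sucMod (λ _ → ⊤) (λ _ _ → tt) forward {zero} tt
      where
        forward : ∀ i → ⊤ → G (c i) (c (sucMod i)) ≡ true
        forward i _ with adjacent i
        ... | inj₁ arc-forward = arc-forward
        ... | inj₂ back        = ⊥-elim (no-back (i , back))

    arcsWithin : VertexSet m → ℕ
    arcsWithin S = sumOver S (outdegIn G S)

    arcsWithin-≤ : ∀ S → arcsWithin S ≤ sum (outdegℕ G)
    arcsWithin-≤ S = ≤-trans (sumOver-≤-sum S (outdegIn G S))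
                             (sum-mono (λ v → sumOver-≤-sum S (λ u → [ G v u ]ℕ)))

    boundary-edge : ∀ (S : VertexSet m) {x y} → UReach G x y → S x ≡ true → S y ≡ false →
                    ∃ λ u → ∃ λ w → S u ≡ true × S w ≡ false × UAdj G u w
    boundary-edge S here x∈S y∉S = ⊥-elim (false≢true (trans (sym y∉S) x∈S))
    boundary-edge S (step {v = v} xv walk) x∈S y∉S with S v in v∈?
    ... | true  = boundary-edge S walk v∈? y∉S
    ... | false = _ , v , x∈S , v∈? , xv

    arcsWithin-insert : ∀ (S : VertexSet m) {w} → S w ≡ false →
      arcsWithin (insert S w) ≡ outdegIn G (insert S w) w + (sumOver S (λ x → [ G x w ]ℕ) + arcsWithin S)
    arcsWithin-insert S {w} w∉S = begin
      arcsWithin (insert S w)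
        ≡⟨ sumOver-insert S (outdegIn G (insert S w)) w∉S ⟩
      outdegIn G (insert S w) w + sumOver S (outdegIn G (insert S w))
        ≡⟨ cong (outdegIn G (insert S w) w +_)
             (trans (sumOver-congʳ S (λ x _ → sumOver-insert S (λ u → [ G x u ]ℕ) w∉S)) (sumOver-+ S _ _)) ⟩
      outdegIn G (insert S w) w + (sumOver S (λ x → [ G x w ]ℕ) + arcsWithin S) ∎
      where open ≡-Reasoning

    boundary-arc : ∀ (S : VertexSet m) {u w} → S u ≡ true → S w ≡ false → UAdj G u w →
                   1 ≤ outdegIn G (insert S w) w + sumOver S (λ x → [ G x w ]ℕ)
    boundary-arc S {w = w} u∈S w∉S (inj₁ uw) =
      ≤-trans (subst (λ b → 1 ≤ [ b ]ℕ) (sym uw) ≤-refl)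
              (≤-trans (member-≤-sumOver S (λ x → [ G x w ]ℕ) u∈S) (m≤n+m _ _))
    boundary-arc S {u} {w} u∈S w∉S (inj₂ wu) =
      ≤-trans (subst (λ b → 1 ≤ [ b ]ℕ) (sym wu) ≤-refl)
              (≤-trans (member-≤-sumOver (insert S w) (λ x → [ G w x ]ℕ) (insert-⊇ S w u∈S)) (m≤m+n _ _))

    -- Grow a vertex set from the root, each time adding a vertex across a boundary edge,
    -- which brings at least one new arc inside.
    grow : WeaklyConnected G → (root : Fin m) → ∀ k → suc k ≤ m →
           ∃ λ S → S root ≡ true × size S ≡ suc k × k ≤ arcsWithin S
    grow connected root zero _ =
      insert ∅ root , ∈-insert ∅ root
      , trans (sumOver-insert ∅ (λ _ → 1) refl) (cong suc (sumOver-zero ∅ (λ _ → 1) (λ _ ()))) , z≤n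
      where
        ∅ : VertexSet m
        ∅ _ = false
    grow connected root (suc k) 2+k≤m
      with grow connected root k (≤-trans (n≤1+n _) 2+k≤m)
    ... | S , root∈S , size≡ , k≤arcs
      with Fin.any? (λ v → S v Bool.≟ false)
    ... | no  S-full = ⊥-elim (<-irrefl size≡m 2+k≤m)
      where
        size≡m : suc k ≡ m
        size≡m = trans (sym size≡) (trans (sumOver-congˡ _ (λ v → ≢false⇒≡true (λ v∉S → S-full (v , v∉S)))) size-full)
    ... | yes (v , v∉S)
      with boundary-edge S (connected root v) root∈S v∉S
    ... | u , w , u∈S , w∉S , uw = insert S w , insert-⊇ S w root∈S , trans (sumOver-insert S _ w∉S) (cong suc size≡) , more-arcs
      where
        more-arcs : suc k ≤ arcsWithin (insert S w)
        more-arcs = subst (suc k ≤_) (sym (arcsWithin-insert S w∉S))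
          (subst (suc k ≤_) (+-assoc (outdegIn G (insert S w) w) (sumOver S (λ x → [ G x w ]ℕ)) (arcsWithin S))
            (+-mono-≤ (boundary-arc S u∈S w∉S uw) k≤arcs))

    weaklyConnected⇒arcs-≥ : WeaklyConnected G → Fin m → m ∸ 1 ≤ sum (outdegℕ G)
    weaklyConnected⇒arcs-≥ connected root
      with S , _ , _ , k≤arcs ← grow connected root (m ∸ 1) (≤-reflexive (suc-∸1 root))
      = ≤-trans k≤arcs (arcsWithin-≤ S)

    acyclic⇒arcs-≤ : Acyclic G → (∀ v → outdegℕ G v ≤ 1) → Fin m → sum (outdegℕ G) ≤ m ∸ 1
    acyclic⇒arcs-≤ acyclic outdeg≤1 root
      with s , sink ← sink-exists G acyclic full {root} refl
      = begin
        sum (outdegℕ G)                                     ≡⟨ sumOver-extract full (outdegℕ G) refl ⟩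
        outdegℕ G s + sumOver (remove full s) (outdegℕ G)   ≡⟨ cong (_+ sumOver (remove full s) (outdegℕ G)) (outdegIn-sink G sink) ⟩
        sumOver (remove full s) (outdegℕ G)                 ≤⟨ sumOver-mono (remove full s) (λ v _ → outdeg≤1 v) ⟩
        size (remove full s)                                ≡⟨ suc-injective (trans (sym (sumOver-extract (full {m}) {s} (λ _ → 1) refl))
                                                                (trans (size-full {m}) (sym (suc-∸1 root)))) ⟩
        m ∸ 1                                               ∎
      where open ≤-Reasoning

  -- The contribution of a vertex of outdegree d inside its part when N vertices lie
  -- outside the part: (N + d)³ − N³.
  shiftedCube : ℕ → ℕ → ℕ
  shiftedCube N d = d * d * d + 3 * N * (d * d) + 3 * (N * N) * d

  shiftedCube-strict : ∀ N → shiftedCube N Preserves _<_ ⟶ _<_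
  shiftedCube-strict N d<d' =
    +-mono-<-≤ (+-mono-<-≤ (*-mono-< (*-mono-< d<d' d<d') d<d')
                           (*-monoʳ-≤ (3 * N) (*-mono-≤ (<⇒≤ d<d') (<⇒≤ d<d'))))
               (*-monoʳ-≤ (3 * (N * N)) (<⇒≤ d<d'))

  shiftedCube-excess : ∀ N d → ∃ λ e → shiftedCube N d ≡ d * shiftedCube N 1 + e × (e ≡ 0 ⇔ d ≤ 1)
  shiftedCube-excess N zero          = 0 , at0 N , mk⇔ (λ _ → z≤n) (λ _ → refl)
    where
      at0 : ∀ N → 0 * 0 * 0 + 3 * N * (0 * 0) + 3 * (N * N) * 0
                  ≡ 0 * (1 * 1 * 1 + 3 * N * (1 * 1) + 3 * (N * N) * 1) + 0
      at0 = solve-∀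
  shiftedCube-excess N (suc zero)    = 0 , at1 N , mk⇔ (λ _ → s≤s z≤n) (λ _ → refl)
    where
      at1 : ∀ N → 1 * 1 * 1 + 3 * N * (1 * 1) + 3 * (N * N) * 1
                  ≡ 1 * (1 * 1 * 1 + 3 * N * (1 * 1) + 3 * (N * N) * 1) + 0
      at1 = solve-∀
  shiftedCube-excess N (suc (suc k)) =
    (2 + k) * (1 + k) * (3 + k) + 3 * N * ((2 + k) * (1 + k)) , at2+ N k , mk⇔ (λ ()) (λ { (s≤s ()) })
    where
      at2+ : ∀ N k → (2 + k) * (2 + k) * (2 + k) + 3 * N * ((2 + k) * (2 + k)) + 3 * (N * N) * (2 + k)
                     ≡ (2 + k) * (1 * 1 * 1 + 3 * N * (1 * 1) + 3 * (N * N) * 1)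
                       + ((2 + k) * (1 + k) * (3 + k) + 3 * N * ((2 + k) * (1 + k)))
      at2+ = solve-∀

  module _ {m : ℕ} (G : Digraph m) where
    private
      D : Fin m → ℕ
      D = outdegℕ G

    -- Σ f(d) ≥ (Σ d) f(1) ≥ (m − 1) f(1) for f = shiftedCube N: the first step is tight
    -- iff every d ≤ 1, and then the second one is tight as well.
    in-tree-bound : WeaklyConnected G → Acyclic G → Fin m → ∀ N →
      (m ∸ 1) * shiftedCube N 1 ≤ sum (λ v → shiftedCube N (D v))
      × ((m ∸ 1) * shiftedCube N 1 ≡ sum (λ v → shiftedCube N (D v)) ⇔ (∀ v → D v ≤ 1))
    in-tree-bound connected acyclic root N = ≤-trans arcs-part linear-part , mk⇔ to from
      where
        f : ℕ → ℕ
        f = shiftedCube N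
        excess : ∀ v → ∃ λ e → f (D v) ≡ D v * f 1 + e × (e ≡ 0 ⇔ D v ≤ 1)
        excess v = shiftedCube-excess N (D v)
        pointwise : ∀ v → D v * f 1 ≤ f (D v)
        pointwise v = subst (D v * f 1 ≤_) (sym (proj₁ (proj₂ (excess v)))) (m≤m+n _ _)
        Σlinear : sum (λ v → D v * f 1) ≡ sum D * f 1
        Σlinear = sym (*-distribʳ-sum (f 1) D)
        arcs-part : (m ∸ 1) * f 1 ≤ sum (λ v → D v * f 1)
        arcs-part = subst ((m ∸ 1) * f 1 ≤_) (sym Σlinear) (*-monoˡ-≤ (f 1) (weaklyConnected⇒arcs-≥ G connected root))
        linear-part : sum (λ v → D v * f 1) ≤ sum (λ v → f (D v))
        linear-part = sum-mono pointwise
        to : (m ∸ 1) * f 1 ≡ sum (λ v → f (D v)) → ∀ v → D v ≤ 1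
        to tight v = Equivalence.to (proj₂ (proj₂ (excess v)))
          (+-cancelˡ-≡ (D v * f 1) _ 0 (trans (sym (proj₁ (proj₂ (excess v))))
            (trans (sym (sum-mono-≡ pointwise (≤-antisym linear-part
              (subst (_≤ sum (λ v → D v * f 1)) tight arcs-part)) v)) (sym (+-identityʳ _)))))
        from : (∀ v → D v ≤ 1) → (m ∸ 1) * f 1 ≡ sum (λ v → f (D v))
        from outdeg≤1 = begin
          (m ∸ 1) * f 1          ≡⟨ cong (_* f 1) (≤-antisym (weaklyConnected⇒arcs-≥ G connected root)
                                      (acyclic⇒arcs-≤ G acyclic outdeg≤1 root)) ⟩
          sum D * f 1            ≡⟨ Σlinear ⟨
          sum (λ v → D v * f 1)  ≡⟨ sum-cong-≗ (λ v → trans (sym (+-identityʳ _)) (trans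
                                      (cong (D v * f 1 +_) (sym (Equivalence.from (proj₂ (proj₂ (excess v))) (outdeg≤1 v)))) 
                                      (sym (proj₁ (proj₂ (excess v)))))) ⟩
          sum (λ v → f (D v))    ∎
          where open ≡-Reasoning

    tournament-bound : Acyclic G → ∀ N →
      sum (λ v → shiftedCube N (D v)) ≤ sumBelow m (shiftedCube N)
      × (sum (λ v → shiftedCube N (D v)) ≡ sumBelow m (shiftedCube N) ⇔ TransitiveTournament G)
    tournament-bound acyclic N
      with bound , tight⇔ ← outdeg-sum-≤-sumBelow G acyclic m full size-full (shiftedCube N) (shiftedCube-strict N)
      = bound , mk⇔ (λ tight → fromOn (Equivalence.to tight⇔ tight)) (λ tt → Equivalence.from tight⇔ (toOn tt))
      where
        fromOn : TournamentOn G full → TransitiveTournament G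
        fromOn (complete , transitive) = (λ u v → complete refl refl) , (λ u v w → transitive refl refl refl)
        toOn : TransitiveTournament G → TournamentOn G full
        toOn (complete , transitive) = (λ {u} {v} _ _ → complete u v) , (λ {u} {v} {w} _ _ _ → transitive u v w)

open import Data.Nat as ℕ using (ℕ; zero; suc; _≤_; _∸_)
import Data.Nat.Properties as ℕ
open import Data.Integer using (ℤ; +_; _+_; _-_; _*_; -_)
import Data.Integer as Z
import Data.Integer.Properties as ℤ
open import Data.Integer.Tactic.RingSolver using (solve-∀)
open import Algebra.Properties.Semiring.Sum ℕ.+-*-semiring using (sum; sum-cong-≗; *-distribˡ-sum)
open import Data.Fin using (Fin; zero; suc; _↑ˡ_; _↑ʳ_; _≟_; splitAt; fromℕ<)
import Data.Fin as F
open import Data.Fin.Properties using (splitAt-↑ˡ; splitAt-↑ʳ; splitAt⁻¹-↑ˡ; splitAt⁻¹-↑ʳ)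
open import Data.Bool using (Bool; true; false; if_then_else_)
open import Data.Empty using (⊥; ⊥-elim)
open import Data.Product using (_×_; _,_; proj₁; proj₂)
open import Data.Sum using (inj₁; inj₂)
open import Relation.Nullary using (does; yes; no)
open import Relation.Binary.PropositionalEquality hiding ([_]; J)
open import Function.Bundles using (_⇔_; mk⇔; Equivalence)
open import Function.Construct.Composition using (_⇔-∘_)
open OutdegreeBounds

sumFin-cong : ∀ n {f g : Fin n → ℤ} → (∀ i → f i ≡ g i) → sumFin n f ≡ sumFin n g
sumFin-cong zero    f≗g = refl
sumFin-cong (suc n) f≗g = cong₂ _+_ (f≗g zero) (sumFin-cong n (λ i → f≗g (suc i)))

sumFin-+ : ∀ n (f g : Fin n → ℤ) → sumFin n (λ i → f i + g i) ≡ sumFin n f + sumFin n g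
sumFin-+ zero    f g = refl
sumFin-+ (suc n) f g =
  trans (cong (_+_ (f zero + g zero)) (sumFin-+ n _ _)) (+-interchange (f zero) (g zero) _ _)
  where
    +-interchange : ∀ a b c d → a + b + (c + d) ≡ a + c + (b + d)
    +-interchange = solve-∀

sumFin-*ˡ : ∀ n c (f : Fin n → ℤ) → sumFin n (λ i → c * f i) ≡ c * sumFin n f
sumFin-*ˡ zero    c f = sym (ℤ.*-zeroʳ c)
sumFin-*ˡ (suc n) c f =
  trans (cong (_+_ (c * f zero)) (sumFin-*ˡ n c _)) (sym (ℤ.*-distribˡ-+ c (f zero) _))

sumFin-*ʳ : ∀ n c (f : Fin n → ℤ) → sumFin n (λ i → f i * c) ≡ sumFin n f * c
sumFin-*ʳ n c f = trans (sumFin-cong n (λ i → ℤ.*-comm (f i) c)) (trans (sumFin-*ˡ n c f) (ℤ.*-comm c _))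

sumFin-neg : ∀ n (f : Fin n → ℤ) → sumFin n (λ i → - f i) ≡ - sumFin n f
sumFin-neg zero    f = refl
sumFin-neg (suc n) f = trans (cong (_+_ (- f zero)) (sumFin-neg n _)) (sym (ℤ.neg-distrib-+ (f zero) _))

sumFin-- : ∀ n (f g : Fin n → ℤ) → sumFin n (λ i → f i - g i) ≡ sumFin n f - sumFin n g
sumFin-- n f g = trans (sumFin-+ n f (λ i → - g i)) (cong (_+_ (sumFin n f)) (sumFin-neg n g))

sumFin-const : ∀ n c → sumFin n (λ _ → c) ≡ + n * c
sumFin-const zero    c = sym (ℤ.*-zeroˡ c)
sumFin-const (suc n) c = trans (cong (_+_ c) (sumFin-const n c)) (unfold c (+ n))
  where
    unfold : ∀ c m → c + m * c ≡ (+ 1 + m) * c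
    unfold = solve-∀

sumFin-zero : ∀ n → sumFin n (λ _ → + 0) ≡ + 0
sumFin-zero n = trans (sumFin-const n (+ 0)) (ℤ.*-zeroʳ (+ n))

sumFin-↑ : ∀ p q (f : Fin (p ℕ.+ q) → ℤ) →
           sumFin (p ℕ.+ q) f ≡ sumFin p (λ i → f (i ↑ˡ q)) + sumFin q (λ j → f (p ↑ʳ j))
sumFin-↑ zero    q f = sym (ℤ.+-identityˡ _)
sumFin-↑ (suc p) q f = trans (cong (_+_ (f zero)) (sumFin-↑ p q (λ i → f (suc i)))) (sym (ℤ.+-assoc (f zero) _ _))

sumFin-comm : ∀ m n (f : Fin m → Fin n → ℤ) →
              sumFin m (λ i → sumFin n (f i)) ≡ sumFin n (λ j → sumFin m (λ i → f i j))
sumFin-comm zero    n f = sym (sumFin-zero n)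
sumFin-comm (suc m) n f =
  trans (cong (_+_ (sumFin n (f zero))) (sumFin-comm m n (λ i → f (suc i))))
        (sym (sumFin-+ n (f zero) (λ j → sumFin m (λ i → f (suc i) j))))

sumFin-pos : ∀ n (f : Fin n → ℕ) → sumFin n (λ i → + f i) ≡ + sum f
sumFin-pos zero    f = refl
sumFin-pos (suc n) f = cong (_+_ (+ f zero)) (sumFin-pos n (λ i → f (suc i)))

δ : ∀ {n} → Fin n → Fin n → ℤ
δ i j = [ does (i ≟ j) ]

δ-refl : ∀ {n} (i : Fin n) → δ i i ≡ + 1
δ-refl zero    = refl
δ-refl (suc i) = δ-refl i

sumFin-δˡ : ∀ n (i : Fin n) (h : Fin n → ℤ) → sumFin n (λ j → δ i j * h j) ≡ h i
sumFin-δˡ (suc n) zero h =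
  trans (cong₂ _+_ (ℤ.*-identityˡ (h zero)) (trans (sumFin-cong n (λ j → ℤ.*-zeroˡ (h (suc j)))) (sumFin-zero n)))
        (ℤ.+-identityʳ _)
sumFin-δˡ (suc n) (suc i) h =
  trans (cong (_+ sumFin n (λ j → δ i j * h (suc j))) (ℤ.*-zeroˡ (h zero)))
        (trans (ℤ.+-identityˡ _) (sumFin-δˡ n i (λ j → h (suc j))))

sumFin-δʳ : ∀ n (i : Fin n) (h : Fin n → ℤ) → sumFin n (λ j → δ j i * h j) ≡ h i
sumFin-δʳ (suc n) zero h =
  trans (cong₂ _+_ (ℤ.*-identityˡ (h zero)) (trans (sumFin-cong n (λ j → ℤ.*-zeroˡ (h (suc j)))) (sumFin-zero n)))
        (ℤ.+-identityʳ _)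
sumFin-δʳ (suc n) (suc i) h =
  trans (cong (_+ sumFin n (λ j → δ j i * h (suc j))) (ℤ.*-zeroˡ (h zero)))
        (trans (ℤ.+-identityˡ _) (sumFin-δʳ n i (λ j → h (suc j))))

sumFin-quartic : ∀ r (a : Fin r → ℤ) c₀ c₁ c₂ c₃ c₄ →
  sumFin r (λ i → c₄ * (a i * a i * a i * a i) + c₃ * (a i * a i * a i) + c₂ * (a i * a i) + c₁ * a i + c₀)
  ≡ c₄ * sumFin r (λ i → a i * a i * a i * a i) + c₃ * sumFin r (λ i → a i * a i * a i)
    + c₂ * sumFin r (λ i → a i * a i) + c₁ * sumFin r a + c₀ * + r
sumFin-quartic zero    a c₀ c₁ c₂ c₃ c₄ = empty c₀ c₁ c₂ c₃ c₄
  where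
    empty : ∀ c₀ c₁ c₂ c₃ c₄ → + 0 ≡ c₄ * + 0 + c₃ * + 0 + c₂ * + 0 + c₁ * + 0 + c₀ * + 0
    empty = solve-∀
sumFin-quartic (suc r) a c₀ c₁ c₂ c₃ c₄ =
  trans (cong (_+_ (c₄ * (x * x * x * x) + c₃ * (x * x * x) + c₂ * (x * x) + c₁ * x + c₀))
              (sumFin-quartic r (λ i → a (suc i)) c₀ c₁ c₂ c₃ c₄))
        (collect x c₀ c₁ c₂ c₃ c₄ _ _ _ _ (+ r))
  where
    x : ℤ
    x = a zero
    collect : ∀ x c₀ c₁ c₂ c₃ c₄ X⁴ X³ X² X R →
      c₄ * (x * x * x * x) + c₃ * (x * x * x) + c₂ * (x * x) + c₁ * x + c₀
        + (c₄ * X⁴ + c₃ * X³ + c₂ * X² + c₁ * X + c₀ * R)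
      ≡ c₄ * (x * x * x * x + X⁴) + c₃ * (x * x * x + X³) + c₂ * (x * x + X²) + c₁ * (x + X) + c₀ * (+ 1 + R)
    collect = solve-∀

sumFin-except : ∀ n (s : Fin n) (f : Fin n → ℤ) → sumFin n (λ v → if does (v ≟ s) then + 0 else f v) ≡ sumFin n f - f s
sumFin-except (suc n) zero    f = trans (ℤ.+-identityˡ _) (cancel (f zero) _)
  where
    cancel : ∀ x y → y ≡ x + y - x
    cancel = solve-∀
sumFin-except (suc n) (suc s) f =
  trans (cong (_+_ (f zero)) (sumFin-except n s (λ i → f (suc i))))
        (sym (ℤ.+-assoc (f zero) (sumFin n (λ i → f (suc i))) (- f (suc s))))

sumFin-total : ∀ r ns → sumFin r (λ i → + ns i) ≡ + total r ns
sumFin-total zero    ns = refl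
sumFin-total (suc r) ns = cong (_+_ (+ ns zero)) (sumFin-total r (λ i → ns (suc i)))

part≤total : ∀ r ns (i : Fin r) → ns i ≤ total r ns
part≤total (suc r) ns zero    = ℕ.m≤m+n _ _
part≤total (suc r) ns (suc i) = ℕ.≤-trans (part≤total r (λ i → ns (suc i)) i) (ℕ.m≤n+m _ _)

+-∸ : ∀ {m k} → k ≤ m → + (m ∸ k) ≡ + m - + k
+-∸ {m} {k} k≤m = trans (sym (ℤ.⊖-≥ k≤m)) (sym (ℤ.m-n≡m⊖n m k))

sumFin-combination : ∀ m (x y z : Fin m → ℤ) b c e →
  sumFin m (λ v → x v + b * y v + c * z v + e) ≡ sumFin m x + b * sumFin m y + c * sumFin m z + + m * e
sumFin-combination m x y z b c e = begin
  sumFin m (λ v → x v + b * y v + c * z v + e)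
    ≡⟨ sumFin-+ m _ _ ⟩
  sumFin m (λ v → x v + b * y v + c * z v) + sumFin m (λ _ → e)
    ≡⟨ cong₂ _+_ (trans (sumFin-+ m _ _) (cong₂ _+_ (trans (sumFin-+ m _ _) (cong (_+_ (sumFin m x)) (sumFin-*ˡ m b y)))
                                                    (sumFin-*ˡ m c z)))
                 (sumFin-const m e) ⟩
  sumFin m x + b * sumFin m y + c * sumFin m z + + m * e ∎
  where open ≡-Reasoning

module _ (m : ℕ) (u : Fin m → ℤ) (k : ℤ) where
  private
    M : ℤ
    M = + m
  sumFin-shift : sumFin m (λ v → u v + k) ≡ sumFin m u + M * k
  sumFin-shift = trans (sumFin-cong m (λ v → pointwise (u v) k))
    (trans (sumFin-combination m u u u (+ 0) (+ 0) k) (collect (sumFin m u) k M))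
    where
      pointwise : ∀ a k → a + k ≡ a + + 0 * a + + 0 * a + k
      pointwise = solve-∀
      collect : ∀ U k M → U + + 0 * U + + 0 * U + M * k ≡ U + M * k
      collect = solve-∀

  sumFin-shift² : sumFin m (λ v → (u v + k) * (u v + k))
                  ≡ sumFin m (λ v → u v * u v) + + 2 * k * sumFin m u + M * (k * k)
  sumFin-shift² = trans (sumFin-cong m (λ v → pointwise (u v) k))
    (trans (sumFin-combination m (λ v → u v * u v) u u (+ 2 * k) (+ 0) (k * k)) (collect (sumFin m (λ v → u v * u v)) (sumFin m u) k M))
    where
      pointwise : ∀ a k → (a + k) * (a + k) ≡ a * a + + 2 * k * a + + 0 * a + k * k
      pointwise = solve-∀
      collect : ∀ U² U k M → U² + + 2 * k * U + + 0 * U + M * (k * k) ≡ U² + + 2 * k * U + M * (k * k)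
      collect = solve-∀

  sumFin-shift³ : sumFin m (λ v → (u v + k) * (u v + k) * (u v + k))
                  ≡ sumFin m (λ v → u v * u v * u v) + + 3 * k * sumFin m (λ v → u v * u v)
                    + + 3 * (k * k) * sumFin m u + M * (k * k * k)
  sumFin-shift³ = trans (sumFin-cong m (λ v → pointwise (u v) k))
    (sumFin-combination m (λ v → u v * u v * u v) (λ v → u v * u v) u (+ 3 * k) (+ 3 * (k * k)) (k * k * k))
    where
      pointwise : ∀ a k → (a + k) * (a + k) * (a + k) ≡ a * a * a + + 3 * k * (a * a) + + 3 * (k * k) * a + k * k * k
      pointwise = solve-∀

  sumFin-shift-* : (w : Fin m → ℤ) → sumFin m (λ v → (u v + k) * (w v + k))
                   ≡ sumFin m (λ v → u v * w v) + k * sumFin m u + k * sumFin m w + M * (k * k)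
  sumFin-shift-* w = trans (sumFin-cong m (λ v → pointwise (u v) (w v) k))
    (sumFin-combination m (λ v → u v * w v) u w k k (k * k))
    where
      pointwise : ∀ a b k → (a + k) * (b + k) ≡ a * b + k * a + k * b + k * k
      pointwise = solve-∀

module _ {n : ℕ} (G : Digraph n) where
  A : Fin n → Fin n → ℤ
  A i j = [ G i j ]

  A² : Fin n → Fin n → ℤ
  A² i j = sumFin n (λ k → A i k * A k j)

  A³ : Fin n → Fin n → ℤ
  A³ i j = sumFin n (λ k → A i k * A² k j)

  private
    d : Fin n → ℤ
    d = outdeg G

    L : Fin n → Fin n → ℤ
    L i j = δ i j * d i - A i j

    L² : Fin n → Fin n → ℤ
    L² i j = sumFin n (λ k → L i k * L k j)

    Laplacian≡L : ∀ i j → Laplacian G i j ≡ L i j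
    Laplacian≡L i j with i ≟ j
    ... | yes _ = cong (_- A i j) (sym (ℤ.*-identityˡ (d i)))
    ... | no  _ = cong (_- A i j) (sym (ℤ.*-zeroˡ (d i)))

    L²≡ : ∀ j i → L² j i ≡ d j * (δ j i * d j - A j i) + - (A j i * d i) + A² j i
    L²≡ j i = begin
      L² j i
        ≡⟨ sumFin-cong n (λ k → expand (δ j k) (d j) (δ k i) (d k) (A k i) (A j k)) ⟩
      sumFin n (λ k → δ j k * (d j * (δ k i * d k - A k i)) + δ k i * (- (A j k * d k)) + A j k * A k i)
        ≡⟨ trans (sumFin-+ n _ _) (cong (_+ A² j i) (sumFin-+ n _ _)) ⟩
      sumFin n (λ k → δ j k * (d j * (δ k i * d k - A k i))) + sumFin n (λ k → δ k i * (- (A j k * d k))) + A² j i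
        ≡⟨ cong₂ (λ x y → x + y + A² j i) (sumFin-δˡ n j (λ k → d j * (δ k i * d k - A k i)))
                                           (sumFin-δʳ n i (λ k → - (A j k * d k))) ⟩
      d j * (δ j i * d j - A j i) + - (A j i * d i) + A² j i ∎
      where
        open ≡-Reasoning
        expand : ∀ δjk dj δki dk aki ajk → (δjk * dj - ajk) * (δki * dk - aki)
                 ≡ δjk * (dj * (δki * dk - aki)) + δki * (- (ajk * dk)) + ajk * aki
        expand = solve-∀

    L³-diag≡ : Loopless G → ∀ i →
      sumFin n (λ j → L i j * L² j i)
      ≡ d i * d i * d i + + 3 * (d i * A² i i) - A³ i i + (sumFin n (λ j → A i j * A j i * d j) - d i * A² i i)
    L³-diag≡ loopless i = begin
      sumFin n (λ j → L i j * L² j i)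
        ≡⟨ sumFin-cong n (λ j → split (δ i j) (d i) (A i j) (L² j i)) ⟩
      sumFin n (λ j → δ i j * (d i * L² j i) + - (A i j * L² j i))
        ≡⟨ trans (sumFin-+ n _ _) (cong₂ _+_ (sumFin-δˡ n i (λ j → d i * L² j i)) (sumFin-neg n _)) ⟩
      d i * L² i i + - sumFin n (λ j → A i j * L² j i)
        ≡⟨ cong₂ (λ x y → d i * x + - y) (L²≡ i i)
             (sumFin-cong n (λ j → trans (cong (A i j *_) (L²≡ j i)) (distribute (A i j) (d j) (δ j i) (A j i) (d i) (A² j i)))) ⟩
      d i * (d i * (δ i i * d i - A i i) + - (A i i * d i) + A² i i)
        + - sumFin n (λ j → δ j i * (A i j * d j * d j) + - (A i j * A j i * d j) + - (A i j * A j i * d i) + A i j * A² j i)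
        ≡⟨ cong (λ z → d i * (d i * (δ i i * d i - A i i) + - (A i i * d i) + A² i i) + - z)
             (trans (sumFin-+ n _ _) (cong (_+ A³ i i) (trans (sumFin-+ n _ _)
               (cong₂ _+_ (trans (sumFin-+ n _ _) (cong₂ _+_ (sumFin-δʳ n i (λ j → A i j * d j * d j)) (sumFin-neg n _)))
                          (trans (sumFin-neg n _) (cong -_ (sumFin-*ʳ n (d i) (λ j → A i j * A j i)))))))) ⟩
      d i * (d i * (δ i i * d i - A i i) + - (A i i * d i) + A² i i)
        + - (A i i * d i * d i + - sumFin n (λ j → A i j * A j i * d j) + - (A² i i * d i) + A³ i i)
        ≡⟨ cong₂ (λ x y → d i * (d i * (x * d i - y) + - (y * d i) + A² i i)
                          + - (y * d i * d i + - sumFin n (λ j → A i j * A j i * d j) + - (A² i i * d i) + A³ i i))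
             (δ-refl i) (cong [_] (loopless i)) ⟩
      d i * (d i * (+ 1 * d i - + 0) + - (+ 0 * d i) + A² i i)
        + - (+ 0 * d i * d i + - sumFin n (λ j → A i j * A j i * d j) + - (A² i i * d i) + A³ i i)
        ≡⟨ collect (d i) (A² i i) (sumFin n (λ j → A i j * A j i * d j)) (A³ i i) ⟩
      d i * d i * d i + + 3 * (d i * A² i i) - A³ i i + (sumFin n (λ j → A i j * A j i * d j) - d i * A² i i) ∎
      where
        open ≡-Reasoning
        split : ∀ δij di aij l → (δij * di - aij) * l ≡ δij * (di * l) + - (aij * l)
        split = solve-∀
        distribute : ∀ aij dj δji aji di a² → aij * (dj * (δji * dj - aji) + - (aji * di) + a²)
                     ≡ δji * (aij * dj * dj) + - (aij * aji * dj) + - (aij * aji * di) + aij * a²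
        distribute = solve-∀
        collect : ∀ d c z w → d * (d * (+ 1 * d - + 0) + - (+ 0 * d) + c) + - (+ 0 * d * d + - z + - (c * d) + w)
                  ≡ d * d * d + + 3 * (d * c) - w + (z - d * c)
        collect = solve-∀

    two-cycle-terms-cancel : sumFin n (λ i → sumFin n (λ j → A i j * A j i * d j) - d i * A² i i) ≡ + 0
    two-cycle-terms-cancel = trans (sumFin-- n _ _) (trans (cong (_- sumFin n (λ i → d i * A² i i)) swap)
                                                           (ℤ.+-inverseʳ (sumFin n (λ i → d i * A² i i))))
      where
        swap : sumFin n (λ i → sumFin n (λ j → A i j * A j i * d j)) ≡ sumFin n (λ i → d i * A² i i)
        swap = trans (sumFin-comm n n (λ i j → A i j * A j i * d j))
          (sumFin-cong n (λ j → trans (sumFin-*ʳ n (d j) (λ i → A i j * A j i))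
            (trans (cong (_* d j) (sumFin-cong n (λ i → ℤ.*-comm (A i j) (A j i)))) (ℤ.*-comm _ (d j)))))

  -- Expanding tr((D − A)³); looplessness makes the diagonal of A vanish.
  LSM3≡ : Loopless G →
    LSM3 G ≡ sumFin n (λ i → outdeg G i * outdeg G i * outdeg G i + + 3 * (outdeg G i * A² i i) - A³ i i)
  LSM3≡ loopless = begin
    LSM3 G
      ≡⟨ sumFin-cong n (λ i → trans (sumFin-cong n (λ j → row i j)) (L³-diag≡ loopless i)) ⟩
    sumFin n (λ i → d i * d i * d i + + 3 * (d i * A² i i) - A³ i i
                    + (sumFin n (λ j → A i j * A j i * d j) - d i * A² i i))
      ≡⟨ sumFin-+ n _ _ ⟩
    sumFin n (λ i → d i * d i * d i + + 3 * (d i * A² i i) - A³ i i)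
      + sumFin n (λ i → sumFin n (λ j → A i j * A j i * d j) - d i * A² i i)
      ≡⟨ trans (cong (_+_ (sumFin n (λ i → d i * d i * d i + + 3 * (d i * A² i i) - A³ i i))) two-cycle-terms-cancel)
               (ℤ.+-identityʳ _) ⟩
    sumFin n (λ i → d i * d i * d i + + 3 * (d i * A² i i) - A³ i i) ∎
    where
      open ≡-Reasoning
      row : ∀ i j → sumFin n (λ k → Laplacian G i j * Laplacian G j k * Laplacian G k i) ≡ L i j * L² j i
      row i j = trans (sumFin-cong n (λ k → trans (cong₂ _*_ (cong₂ _*_ (Laplacian≡L i j) (Laplacian≡L j k)) (Laplacian≡L k i))
                                                  (ℤ.*-assoc (L i j) (L j k) (L k i))))
                      (sumFin-*ˡ n (L i j) (λ k → L j k * L k i))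

module _ {m : ℕ} (K : Digraph m) where
  Σd Σd² Σd³ trA² trDA² trA³ : ℤ
  Σd    = sumFin m (outdeg K)
  Σd²   = sumFin m (λ i → outdeg K i * outdeg K i)
  Σd³   = sumFin m (λ i → outdeg K i * outdeg K i * outdeg K i)
  trA²  = sumFin m (λ i → A² K i i)
  trDA² = sumFin m (λ i → outdeg K i * A² K i i)
  trA³  = sumFin m (λ i → A³ K i i)

  LSM3≡stats : Loopless K → LSM3 K ≡ Σd³ + + 3 * trDA² - trA³
  LSM3≡stats loopless = trans (LSM3≡ K loopless)
    (trans (sumFin-- m _ (λ i → A³ K i i)) (cong (_- trA³) (trans (sumFin-+ m _ _) (cong (_+_ Σd³) (sumFin-*ˡ m (+ 3) _)))))

  indeg : Fin m → ℤ
  indeg i = sumFin m (λ k → A K k i)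

  indegree-sum : sumFin m indeg ≡ Σd
  indegree-sum = sym (sumFin-comm m m (A K))

module _ {p q : ℕ} (G : Digraph p) (H : Digraph q) where
  private
    J : Digraph (p ℕ.+ q)
    J = join G H
    P Q : ℤ
    P = + p
    Q = + q

  A-join-↑ˡ↑ˡ : ∀ x x' → A J (x ↑ˡ q) (x' ↑ˡ q) ≡ A G x x'
  A-join-↑ˡ↑ˡ x x' rewrite splitAt-↑ˡ p x q | splitAt-↑ˡ p x' q = refl

  A-join-↑ˡ↑ʳ : ∀ x y → A J (x ↑ˡ q) (p ↑ʳ y) ≡ + 1
  A-join-↑ˡ↑ʳ x y rewrite splitAt-↑ˡ p x q | splitAt-↑ʳ p q y = refl

  A-join-↑ʳ↑ˡ : ∀ y x → A J (p ↑ʳ y) (x ↑ˡ q) ≡ + 1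
  A-join-↑ʳ↑ˡ y x rewrite splitAt-↑ˡ p x q | splitAt-↑ʳ p q y = refl

  A-join-↑ʳ↑ʳ : ∀ y y' → A J (p ↑ʳ y) (p ↑ʳ y') ≡ A H y y'
  A-join-↑ʳ↑ʳ y y' rewrite splitAt-↑ʳ p q y | splitAt-↑ʳ p q y' = refl

  loopless-join : Loopless G → Loopless H → Loopless J
  loopless-join loopless-G loopless-H i = by-side (splitAt p i) refl
    where
      by-side : ∀ s → splitAt p i ≡ s → J i i ≡ false
      by-side (inj₁ x) eq = subst (λ z → J z z ≡ false) (splitAt⁻¹-↑ˡ eq) (trans (arc-ll x) (loopless-G x))
        where arc-ll : ∀ x → J (x ↑ˡ q) (x ↑ˡ q) ≡ G x x
              arc-ll x rewrite splitAt-↑ˡ p x q = refl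
      by-side (inj₂ y) eq = subst (λ z → J z z ≡ false) (splitAt⁻¹-↑ʳ eq) (trans (arc-rr y) (loopless-H y))
        where arc-rr : ∀ y → J (p ↑ʳ y) (p ↑ʳ y) ≡ H y y
              arc-rr y rewrite splitAt-↑ʳ p q y = refl

  private
    sumFin-ones : ∀ n → sumFin n (λ _ → + 1) ≡ + n
    sumFin-ones n = trans (sumFin-const n (+ 1)) (ℤ.*-identityʳ (+ n))

    ones : ∀ {n} {f : Fin n → ℤ} → (∀ i → f i ≡ + 1) → sumFin n f ≡ + n
    ones {n} f≗1 = trans (sumFin-cong n f≗1) (sumFin-ones n)

    ·1 : ∀ {a b x} → a ≡ x → b ≡ + 1 → a * b ≡ x
    ·1 {x = x} refl refl = ℤ.*-identityʳ x

    1· : ∀ {a b x} → a ≡ + 1 → b ≡ x → a * b ≡ x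
    1· {x = x} refl refl = ℤ.*-identityˡ x

    1·1 : ∀ {a b} → a ≡ + 1 → b ≡ + 1 → a * b ≡ + 1
    1·1 refl refl = refl

  outdeg-join-↑ˡ : ∀ x → outdeg J (x ↑ˡ q) ≡ outdeg G x + Q
  outdeg-join-↑ˡ x = trans (sumFin-↑ p q _)
    (cong₂ _+_ (sumFin-cong p (A-join-↑ˡ↑ˡ x)) (ones (A-join-↑ˡ↑ʳ x)))

  outdeg-join-↑ʳ : ∀ y → outdeg J (p ↑ʳ y) ≡ outdeg H y + P
  outdeg-join-↑ʳ y = trans (sumFin-↑ p q _)
    (trans (cong₂ _+_ (ones (A-join-↑ʳ↑ˡ y)) (sumFin-cong q (A-join-↑ʳ↑ʳ y))) (ℤ.+-comm P (outdeg H y)))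

  A²-join-↑ˡ↑ˡ : ∀ x' x → A² J (x' ↑ˡ q) (x ↑ˡ q) ≡ A² G x' x + Q
  A²-join-↑ˡ↑ˡ x' x = trans (sumFin-↑ p q _)
    (cong₂ _+_ (sumFin-cong p (λ u → cong₂ _*_ (A-join-↑ˡ↑ˡ x' u) (A-join-↑ˡ↑ˡ u x)))
               (ones (λ y → 1·1 (A-join-↑ˡ↑ʳ x' y) (A-join-↑ʳ↑ˡ y x))))

  A²-join-↑ʳ↑ʳ : ∀ y' y → A² J (p ↑ʳ y') (p ↑ʳ y) ≡ A² H y' y + P
  A²-join-↑ʳ↑ʳ y' y = trans (sumFin-↑ p q _)
    (trans (cong₂ _+_ (ones (λ x → 1·1 (A-join-↑ʳ↑ˡ y' x) (A-join-↑ˡ↑ʳ x y)))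
                      (sumFin-cong q (λ u → cong₂ _*_ (A-join-↑ʳ↑ʳ y' u) (A-join-↑ʳ↑ʳ u y))))
           (ℤ.+-comm P (A² H y' y)))

  A²-join-↑ʳ↑ˡ : ∀ y x → A² J (p ↑ʳ y) (x ↑ˡ q) ≡ indeg G x + outdeg H y
  A²-join-↑ʳ↑ˡ y x = trans (sumFin-↑ p q _)
    (cong₂ _+_ (sumFin-cong p (λ u → 1· (A-join-↑ʳ↑ˡ y u) (A-join-↑ˡ↑ˡ u x)))
               (sumFin-cong q (λ u → ·1 (A-join-↑ʳ↑ʳ y u) (A-join-↑ʳ↑ˡ u x))))

  A²-join-↑ˡ↑ʳ : ∀ x y → A² J (x ↑ˡ q) (p ↑ʳ y) ≡ outdeg G x + indeg H y
  A²-join-↑ˡ↑ʳ x y = trans (sumFin-↑ p q _)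
    (cong₂ _+_ (sumFin-cong p (λ u → ·1 (A-join-↑ˡ↑ˡ x u) (A-join-↑ˡ↑ʳ u y)))
               (sumFin-cong q (λ u → 1· (A-join-↑ˡ↑ʳ x u) (A-join-↑ʳ↑ʳ u y))))

  A³-join-↑ˡ : ∀ x → A³ J (x ↑ˡ q) (x ↑ˡ q) ≡ A³ G x x + Q * outdeg G x + (Q * indeg G x + Σd H)
  A³-join-↑ˡ x = trans (sumFin-↑ p q _) (cong₂ _+_
    (trans (sumFin-cong p (λ u → trans (cong₂ _*_ (A-join-↑ˡ↑ˡ x u) (A²-join-↑ˡ↑ˡ u x))
                                       (distrib (A G x u) (A² G u x) Q)))
           (trans (sumFin-+ p _ _) (cong (_+_ (A³ G x x)) (sumFin-*ˡ p Q (A G x)))))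
    (trans (sumFin-cong q (λ y → 1· (A-join-↑ˡ↑ʳ x y) (A²-join-↑ʳ↑ˡ y x)))
           (trans (sumFin-+ q _ _) (cong (_+ Σd H) (sumFin-const q (indeg G x))))))
    where
      distrib : ∀ a b k → a * (b + k) ≡ a * b + k * a
      distrib = solve-∀

  A³-join-↑ʳ : ∀ y → A³ J (p ↑ʳ y) (p ↑ʳ y) ≡ A³ H y y + P * outdeg H y + (P * indeg H y + Σd G)
  A³-join-↑ʳ y = trans (sumFin-↑ p q _) (trans (cong₂ _+_
    (trans (sumFin-cong p (λ u → 1· (A-join-↑ʳ↑ˡ y u) (A²-join-↑ˡ↑ʳ u y)))
           (trans (sumFin-+ p _ _) (cong (_+_ (Σd G)) (sumFin-const p (indeg H y)))))
    (trans (sumFin-cong q (λ u → trans (cong₂ _*_ (A-join-↑ʳ↑ʳ y u) (A²-join-↑ʳ↑ʳ u y))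
                                       (distrib (A H y u) (A² H u y) P)))
           (trans (sumFin-+ q _ _) (cong (_+_ (A³ H y y)) (sumFin-*ˡ q P (A H y))))))
    (reorder (Σd G) (P * indeg H y) (A³ H y y) (P * outdeg H y)))
    where
      distrib : ∀ a b k → a * (b + k) ≡ a * b + k * a
      distrib = solve-∀
      reorder : ∀ s e w b → s + e + (w + b) ≡ w + b + (e + s)
      reorder = solve-∀

module _ {p q : ℕ} (G : Digraph p) (H : Digraph q) where
  private
    J : Digraph (p ℕ.+ q)
    J = join G H
    P Q : ℤ
    P = + p
    Q = + q

  Σd-join : Σd J ≡ (Σd G + P * Q) + (Σd H + Q * P)
  Σd-join = trans (sumFin-↑ p q _) (cong₂ _+_
    (trans (sumFin-cong p (outdeg-join-↑ˡ G H)) (sumFin-shift p (outdeg G) Q))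
    (trans (sumFin-cong q (outdeg-join-↑ʳ G H)) (sumFin-shift q (outdeg H) P)))

  Σd²-join : Σd² J ≡ (Σd² G + + 2 * Q * Σd G + P * (Q * Q)) + (Σd² H + + 2 * P * Σd H + Q * (P * P))
  Σd²-join = trans (sumFin-↑ p q _) (cong₂ _+_
    (trans (sumFin-cong p (λ x → cong₂ _*_ (outdeg-join-↑ˡ G H x) (outdeg-join-↑ˡ G H x))) (sumFin-shift² p (outdeg G) Q))
    (trans (sumFin-cong q (λ y → cong₂ _*_ (outdeg-join-↑ʳ G H y) (outdeg-join-↑ʳ G H y))) (sumFin-shift² q (outdeg H) P)))

  Σd³-join : Σd³ J ≡ (Σd³ G + + 3 * Q * Σd² G + + 3 * (Q * Q) * Σd G + P * (Q * Q * Q))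
                   + (Σd³ H + + 3 * P * Σd² H + + 3 * (P * P) * Σd H + Q * (P * P * P))
  Σd³-join = trans (sumFin-↑ p q _) (cong₂ _+_
    (trans (sumFin-cong p (λ x → cube (outdeg-join-↑ˡ G H x))) (sumFin-shift³ p (outdeg G) Q))
    (trans (sumFin-cong q (λ y → cube (outdeg-join-↑ʳ G H y))) (sumFin-shift³ q (outdeg H) P)))
    where
      cube : ∀ {a b} → a ≡ b → a * a * a ≡ b * b * b
      cube refl = refl

  trA²-join : trA² J ≡ (trA² G + P * Q) + (trA² H + Q * P)
  trA²-join = trans (sumFin-↑ p q _) (cong₂ _+_
    (trans (sumFin-cong p (λ x → A²-join-↑ˡ↑ˡ G H x x)) (sumFin-shift p (λ x → A² G x x) Q))
    (trans (sumFin-cong q (λ y → A²-join-↑ʳ↑ʳ G H y y)) (sumFin-shift q (λ y → A² H y y) P)))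

  trDA²-join : trDA² J ≡ (trDA² G + Q * Σd G + Q * trA² G + P * (Q * Q))
                       + (trDA² H + P * Σd H + P * trA² H + Q * (P * P))
  trDA²-join = trans (sumFin-↑ p q _) (cong₂ _+_
    (trans (sumFin-cong p (λ x → cong₂ _*_ (outdeg-join-↑ˡ G H x) (A²-join-↑ˡ↑ˡ G H x x)))
           (sumFin-shift-* p (outdeg G) Q (λ x → A² G x x)))
    (trans (sumFin-cong q (λ y → cong₂ _*_ (outdeg-join-↑ʳ G H y) (A²-join-↑ʳ↑ʳ G H y y)))
           (sumFin-shift-* q (outdeg H) P (λ y → A² H y y))))

  trA³-join : trA³ J ≡ (trA³ G + Q * Σd G + Q * Σd G + P * Σd H) + (trA³ H + P * Σd H + P * Σd H + Q * Σd G)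
  trA³-join = trans (sumFin-↑ p q _) (cong₂ _+_
    (trans (sumFin-cong p (λ x → trans (A³-join-↑ˡ G H x) (reassoc (A³ G x x) (Q * outdeg G x) (Q * indeg G x) (Σd H))))
           (trans (sumFin-combination p (λ x → A³ G x x) (outdeg G) (indeg G) Q Q (Σd H))
                  (cong (λ e → trA³ G + Q * Σd G + Q * e + P * Σd H) (indegree-sum G))))
    (trans (sumFin-cong q (λ y → trans (A³-join-↑ʳ G H y) (reassoc (A³ H y y) (P * outdeg H y) (P * indeg H y) (Σd G))))
           (trans (sumFin-combination q (λ y → A³ H y y) (outdeg H) (indeg H) P P (Σd G))
                  (cong (λ e → trA³ H + P * Σd H + P * e + Q * Σd G) (indegree-sum H)))))
    where
      reassoc : ∀ w b e s → w + b + (e + s) ≡ w + b + e + s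
      reassoc = solve-∀

module _ {m : ℕ} (K : Digraph m) (acyclic : Acyclic K) where
  private
    [_]*[_]≡0 : ∀ b b' → (b ≡ true → b' ≡ true → ⊥) → [ b ] * [ b' ] ≡ + 0
    [ true ]*[ true ]≡0  no-walk = ⊥-elim (no-walk refl refl)
    [ true ]*[ false ]≡0 _       = refl
    [ false ]*[ _ ]≡0    _       = refl

    [_]*≡0 : ∀ b x → (b ≡ true → x ≡ + 0) → [ b ] * x ≡ + 0
    [ true ]*≡0  x x≡0 = trans (ℤ.*-identityˡ x) (x≡0 refl)
    [ false ]*≡0 x _   = refl

    sumFin-zeros : ∀ {n} {f : Fin n → ℤ} → (∀ i → f i ≡ + 0) → sumFin n f ≡ + 0
    sumFin-zeros {n} f≗0 = trans (sumFin-cong n f≗0) (sumFin-zero n)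

  acyclic⇒A²-diag : ∀ v → A² K v v ≡ + 0
  acyclic⇒A²-diag v = sumFin-zeros (λ k → [ K v k ]*[ K k v ]≡0 (λ vk kv → acyclic v (vk ∷ₐ arc kv)))

  acyclic⇒A³-diag : ∀ v → A³ K v v ≡ + 0
  acyclic⇒A³-diag v = sumFin-zeros (λ j → [ K v j ]*≡0 _ (λ vj → sumFin-zeros (λ k →
    [ K j k ]*[ K k v ]≡0 (λ jk kv → acyclic v (vj ∷ₐ (jk ∷ₐ arc kv))))))

  acyclic⇒trA² : trA² K ≡ + 0
  acyclic⇒trA² = sumFin-zeros acyclic⇒A²-diag

  acyclic⇒trDA² : trDA² K ≡ + 0
  acyclic⇒trDA² = sumFin-zeros (λ v → trans (cong (outdeg K v *_) (acyclic⇒A²-diag v)) (ℤ.*-zeroʳ (outdeg K v)))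

  acyclic⇒trA³ : trA³ K ≡ + 0
  acyclic⇒trA³ = sumFin-zeros acyclic⇒A³-diag

shiftedCubeℤ : ℤ → ℤ → ℤ
shiftedCubeℤ N d = d * d * d + + 3 * N * (d * d) + + 3 * (N * N) * d

-- 4 Σ_{k<m} shiftedCube N k, by Faulhaber's formulas for Σ k, Σ k² and Σ k³.
sumBelowShiftedCube×4 : ℤ → ℤ → ℤ
sumBelowShiftedCube×4 m N =
  m * m * (m - + 1) * (m - + 1) + + 2 * N * (m - + 1) * m * (+ 2 * m - + 1) + + 6 * (N * N) * m * (m - + 1)

module PowerSums (r : ℕ) (ns : Fin r → ℕ) where
  n : ℤ
  n = + total r ns

  a : Fin r → ℤ
  a i = + ns i

  Σa² Σa³ Σa⁴ : ℤ
  Σa² = sumFin r (λ i → a i * a i)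
  Σa³ = sumFin r (λ i → a i * a i * a i)
  Σa⁴ = sumFin r (λ i → a i * a i * a i * a i)

  sumFin-polynomial : ∀ {f : Fin r → ℤ} c₀ c₁ c₂ c₃ c₄ →
    (∀ i → f i ≡ c₄ * (a i * a i * a i * a i) + c₃ * (a i * a i * a i) + c₂ * (a i * a i) + c₁ * a i + c₀) →
    sumFin r f ≡ c₄ * Σa⁴ + c₃ * Σa³ + c₂ * Σa² + c₁ * n + c₀ * + r
  sumFin-polynomial c₀ c₁ c₂ c₃ c₄ pointwise =
    trans (sumFin-cong r pointwise) (trans (sumFin-quartic r a c₀ c₁ c₂ c₃ c₄)
      (cong (λ Σa → c₄ * Σa⁴ + c₃ * Σa³ + c₂ * Σa² + c₁ * Σa + c₀ * + r) (sumFin-total r ns)))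

  crossTerm≡ : crossTerm r ns ≡ n * n * n - + 3 * n * Σa² + + 2 * Σa³
  crossTerm≡ = trans (sumFin-polynomial (+ 0) (n * n - Σa²) (- (n + n)) (+ 2) (+ 0)
                       (λ i → trans (cong (a i *_) (inner i)) (outer (a i) n Σa² Σa³ Σa⁴ (+ r))))
                     (collect n Σa² Σa³ Σa⁴ (+ r))
    where
      inner : ∀ i → sumFin r (λ s → if does (s ≟ i) then + 0 else a s * (n - a s - a i))
                    ≡ (+ 0 * Σa⁴ + + 0 * Σa³ + - + 1 * Σa² + (n - a i) * n + + 0 * + r) - a i * (n - a i - a i)
      inner i = trans (sumFin-except r i (λ s → a s * (n - a s - a i)))
        (cong (_- a i * (n - a i - a i)) (sumFin-polynomial (+ 0) (n - a i) (- + 1) (+ 0) (+ 0) (λ s → pointwise (a s) (a i) n)))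
        where
          pointwise : ∀ x y n → x * (n - x - y) ≡ + 0 * (x * x * x * x) + + 0 * (x * x * x) + - + 1 * (x * x) + (n - y) * x + + 0
          pointwise = solve-∀
      outer : ∀ x n X² X³ X⁴ R → x * ((+ 0 * X⁴ + + 0 * X³ + - + 1 * X² + (n - x) * n + + 0 * R) - x * (n - x - x))
              ≡ + 0 * (x * x * x * x) + + 2 * (x * x * x) + - (n + n) * (x * x) + (n * n - X²) * x + + 0
      outer = solve-∀
      collect : ∀ n X² X³ X⁴ R → + 0 * X⁴ + + 2 * X³ + - (n + n) * X² + (n * n - X²) * n + + 0 * R
                ≡ n * n * n - + 3 * n * X² + + 2 * X³
      collect = solve-∀

  -- LSM₃ of the complete multipartite digraph with parts of sizes n₁, …, n_r.
  multipartiteLSM3 : ℤ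
  multipartiteLSM3 = n * n * n * n + + 2 * (n * n * n) - + 3 * (n * n) * Σa² - + 3 * n * Σa² + + 3 * n * Σa³ + Σa³ - Σa⁴

  lowerBound≡ : lowerBound r ns ≡ sumFin r (λ i → (a i - + 1) * shiftedCubeℤ (n - a i) (+ 1)) + multipartiteLSM3
  lowerBound≡ = begin
    lowerBound r ns
      ≡⟨ cong₂ (λ S X → S - + r * (+ 3 * (n * (n * + 1)) + + 3 * n + + 1) - X)
               (sumFin-polynomial (+ 0) (n * n * n + + 6 * (n * n) + + 9 * n + + 4) (- (+ 3 * (n * n) + + 12 * n + + 6))
                                  (+ 3 * n + + 6) (- + 1) (λ i → bound-part n (a i)))
               crossTerm≡ ⟩
    (- + 1 * Σa⁴ + (+ 3 * n + + 6) * Σa³ + - (+ 3 * (n * n) + + 12 * n + + 6) * Σa² + (n * n * n + + 6 * (n * n) + + 9 * n + + 4) * n + + 0 * + r)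
      - + r * (+ 3 * (n * (n * + 1)) + + 3 * n + + 1) - (n * n * n - + 3 * n * Σa² + + 2 * Σa³)
      ≡⟨ regroup n (+ r) Σa² Σa³ Σa⁴ ⟩
    (+ 0 * Σa⁴ + + 3 * Σa³ + (- + 6 + - + 6 * n) * Σa² + (+ 4 + + 9 * n + + 3 * (n * n)) * n + (- + 1 + - + 3 * n + - + 3 * (n * n)) * + r)
      + multipartiteLSM3
      ≡⟨ cong (_+ multipartiteLSM3) (sumFin-polynomial (- + 1 + - + 3 * n + - + 3 * (n * n)) (+ 4 + + 9 * n + + 3 * (n * n))
                                       (- + 6 + - + 6 * n) (+ 3) (+ 0) (λ i → in-tree-part n (a i))) ⟨
    sumFin r (λ i → (a i - + 1) * shiftedCubeℤ (n - a i) (+ 1)) + multipartiteLSM3 ∎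
    where
      open ≡-Reasoning
      bound-part : ∀ n x →
        - (x * (x * (x * (x * + 1)))) + (+ 3 * n + + 6) * (x * (x * (x * + 1)))
        - (+ 3 * (n * (n * + 1)) + + 12 * n + + 6) * (x * (x * + 1)) + (n * (n * (n * + 1)) + + 6 * (n * (n * + 1)) + + 9 * n + + 4) * x
        ≡ - + 1 * (x * x * x * x) + (+ 3 * n + + 6) * (x * x * x) + - (+ 3 * (n * n) + + 12 * n + + 6) * (x * x)
          + (n * n * n + + 6 * (n * n) + + 9 * n + + 4) * x + + 0
      bound-part = solve-∀
      in-tree-part : ∀ n x →
        (x - + 1) * ((+ 1 * + 1 * + 1) + + 3 * (n - x) * (+ 1 * + 1) + + 3 * ((n - x) * (n - x)) * + 1)
        ≡ + 0 * (x * x * x * x) + + 3 * (x * x * x) + (- + 6 + - + 6 * n) * (x * x) + (+ 4 + + 9 * n + + 3 * (n * n)) * x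
          + (- + 1 + - + 3 * n + - + 3 * (n * n))
      in-tree-part = solve-∀
      regroup : ∀ n R X² X³ X⁴ →
        (- + 1 * X⁴ + (+ 3 * n + + 6) * X³ + - (+ 3 * (n * n) + + 12 * n + + 6) * X² + (n * n * n + + 6 * (n * n) + + 9 * n + + 4) * n + + 0 * R)
          - R * (+ 3 * (n * (n * + 1)) + + 3 * n + + 1) - (n * n * n - + 3 * n * X² + + 2 * X³)
        ≡ (+ 0 * X⁴ + + 3 * X³ + (- + 6 + - + 6 * n) * X² + (+ 4 + + 9 * n + + 3 * (n * n)) * n + (- + 1 + - + 3 * n + - + 3 * (n * n)) * R)
          + (n * n * n * n + + 2 * (n * n * n) - + 3 * (n * n) * X² - + 3 * n * X² + + 3 * n * X³ + X³ - X⁴)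
      regroup = solve-∀

  upperBound×4≡ : upperBound×4 r ns ≡ sumFin r (λ i → sumBelowShiftedCube×4 (a i) (n - a i)) + + 4 * multipartiteLSM3
  upperBound×4≡ = begin
    upperBound×4 r ns
      ≡⟨ cong₂ (λ S X → S - + 4 * X)
               (sumFin-polynomial (+ 0) (+ 4 * (n * n * n) + + 6 * (n * n) + + 2 * n) (- (+ 6 * (n * n) + + 18 * n + + 1))
                                  (+ 4 * n + + 10) (- + 1) (λ i → bound-part n (a i)))
               crossTerm≡ ⟩
    (- + 1 * Σa⁴ + (+ 4 * n + + 10) * Σa³ + - (+ 6 * (n * n) + + 18 * n + + 1) * Σa² + (+ 4 * (n * n * n) + + 6 * (n * n) + + 2 * n) * n + + 0 * + r)
      - + 4 * (n * n * n - + 3 * n * Σa² + + 2 * Σa³)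
      ≡⟨ regroup n (+ r) Σa² Σa³ Σa⁴ ⟩
    (+ 3 * Σa⁴ + (- + 2 + - + 8 * n) * Σa³ + (- + 1 + + 6 * n + + 6 * (n * n)) * Σa² + (+ 2 * n + - + 6 * (n * n)) * n + + 0 * + r)
      + + 4 * multipartiteLSM3
      ≡⟨ cong (_+ + 4 * multipartiteLSM3) (sumFin-polynomial (+ 0) (+ 2 * n + - + 6 * (n * n)) (- + 1 + + 6 * n + + 6 * (n * n))
                                             (- + 2 + - + 8 * n) (+ 3) (λ i → tournament-part n (a i))) ⟨
    sumFin r (λ i → sumBelowShiftedCube×4 (a i) (n - a i)) + + 4 * multipartiteLSM3 ∎
    where
      open ≡-Reasoning
      bound-part : ∀ n x →
        - (x * (x * (x * (x * + 1)))) + (+ 4 * n + + 10) * (x * (x * (x * + 1)))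
        - (+ 6 * (n * (n * + 1)) + + 18 * n + + 1) * (x * (x * + 1)) + (+ 4 * (n * (n * (n * + 1))) + + 6 * (n * (n * + 1)) + + 2 * n) * x
        ≡ - + 1 * (x * x * x * x) + (+ 4 * n + + 10) * (x * x * x) + - (+ 6 * (n * n) + + 18 * n + + 1) * (x * x)
          + (+ 4 * (n * n * n) + + 6 * (n * n) + + 2 * n) * x + + 0
      bound-part = solve-∀
      tournament-part : ∀ n x →
        x * x * (x - + 1) * (x - + 1) + + 2 * (n - x) * (x - + 1) * x * (+ 2 * x - + 1) + + 6 * ((n - x) * (n - x)) * x * (x - + 1)
        ≡ + 3 * (x * x * x * x) + (- + 2 + - + 8 * n) * (x * x * x) + (- + 1 + + 6 * n + + 6 * (n * n)) * (x * x)
          + (+ 2 * n + - + 6 * (n * n)) * x + + 0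
      tournament-part = solve-∀
      regroup : ∀ n R X² X³ X⁴ →
        (- + 1 * X⁴ + (+ 4 * n + + 10) * X³ + - (+ 6 * (n * n) + + 18 * n + + 1) * X² + (+ 4 * (n * n * n) + + 6 * (n * n) + + 2 * n) * n + + 0 * R)
          - + 4 * (n * n * n - + 3 * n * X² + + 2 * X³)
        ≡ (+ 3 * X⁴ + (- + 2 + - + 8 * n) * X³ + (- + 1 + + 6 * n + + 6 * (n * n)) * X² + (+ 2 * n + - + 6 * (n * n)) * n + + 0 * R)
          + + 4 * (n * n * n * n + + 2 * (n * n * n) - + 3 * (n * n) * X² - + 3 * n * X² + + 3 * n * X³ + X³ - X⁴)
      regroup = solve-∀

module PartSums (r : ℕ) (ns : Fin r → ℕ) (Vs : (i : Fin r) → Digraph (ns i)) where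
  open PowerSums r ns public

  ΣΣd ΣaΣd Σa²Σd ΣΣd² ΣaΣd² ΣΣd³ : ℤ
  ΣΣd   = sumFin r (λ i → Σd (Vs i))
  ΣaΣd  = sumFin r (λ i → a i * Σd (Vs i))
  Σa²Σd = sumFin r (λ i → a i * a i * Σd (Vs i))
  ΣΣd²  = sumFin r (λ i → Σd² (Vs i))
  ΣaΣd² = sumFin r (λ i → a i * Σd² (Vs i))
  ΣΣd³  = sumFin r (λ i → Σd³ (Vs i))

private
  module FirstPart {r : ℕ} (ns : Fin (suc r) → ℕ) (Vs : (i : Fin (suc r)) → Digraph (ns i)) where
    G : Digraph (ns zero)
    G = Vs zero
    H : Digraph (total r (λ i → ns (suc i)))
    H = joinAll r (λ i → ns (suc i)) (λ i → Vs (suc i))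
    p q : ℤ
    p = + ns zero
    q = + total r (λ i → ns (suc i))
    module Rest = PartSums r (λ i → ns (suc i)) (λ i → Vs (suc i))
    module All = PartSums (suc r) ns Vs

-- Each statistic of V ∨ W is a polynomial in those of V and W, so by induction on r
-- the statistics of V¹ ∨ ⋯ ∨ Vʳ are polynomials in the power sums of the parts.
Σd-joinAll : ∀ r ns Vs → let open PartSums r ns Vs in Σd (joinAll r ns Vs) ≡ ΣΣd + n * n - Σa²
Σd-joinAll zero    ns Vs = refl
Σd-joinAll (suc r) ns Vs = trans (Σd-join G H) (close (Σd-joinAll r _ _))
  where
    open FirstPart ns Vs
    close : ∀ {X} → X ≡ Rest.ΣΣd + q * q - Rest.Σa² → Σd G + p * q + (X + q * p) ≡ All.ΣΣd + All.n * All.n - All.Σa²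
    close refl = identity p q (Σd G) Rest.ΣΣd Rest.Σa²
      where
        identity : ∀ p q s Q P → s + p * q + ((Q + q * q - P) + q * p) ≡ (s + Q) + (p + q) * (p + q) - (p * p + P)
        identity = solve-∀

Σd²-joinAll : ∀ r ns Vs → let open PartSums r ns Vs in
  Σd² (joinAll r ns Vs) ≡ ΣΣd² + + 2 * n * ΣΣd - + 2 * ΣaΣd + n * n * n - + 2 * n * Σa² + Σa³
Σd²-joinAll zero    ns Vs = refl
Σd²-joinAll (suc r) ns Vs = trans (Σd²-join G H) (close (Σd²-joinAll r _ _) (Σd-joinAll r _ _))
  where
    open FirstPart ns Vs
    close : ∀ {X Y} → X ≡ Rest.ΣΣd² + + 2 * q * Rest.ΣΣd - + 2 * Rest.ΣaΣd + q * q * q - + 2 * q * Rest.Σa² + Rest.Σa³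
                     → Y ≡ Rest.ΣΣd + q * q - Rest.Σa²
                     → (Σd² G + + 2 * q * Σd G + p * (q * q)) + (X + + 2 * p * Y + q * (p * p))
                       ≡ All.ΣΣd² + + 2 * All.n * All.ΣΣd - + 2 * All.ΣaΣd + All.n * All.n * All.n
                         - + 2 * All.n * All.Σa² + All.Σa³
    close refl refl = identity p q (Σd G) (Σd² G) Rest.ΣΣd Rest.ΣaΣd Rest.ΣΣd² Rest.Σa² Rest.Σa³
      where
        identity : ∀ p q s₁ s₂ Q₀ Q₁ R₀ P₂ P₃ →
          (s₂ + + 2 * q * s₁ + p * (q * q))
          + ((R₀ + + 2 * q * Q₀ - + 2 * Q₁ + q * q * q - + 2 * q * P₂ + P₃) + + 2 * p * (Q₀ + q * q - P₂) + q * (p * p))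
          ≡ (s₂ + R₀) + + 2 * (p + q) * (s₁ + Q₀) - + 2 * (p * s₁ + Q₁) + (p + q) * (p + q) * (p + q)
            - + 2 * (p + q) * (p * p + P₂) + (p * p * p + P₃)
        identity = solve-∀

Σd³-joinAll : ∀ r ns Vs → let open PartSums r ns Vs in
  Σd³ (joinAll r ns Vs) ≡ ΣΣd³ + + 3 * n * ΣΣd² - + 3 * ΣaΣd² + + 3 * (n * n) * ΣΣd - + 6 * n * ΣaΣd + + 3 * Σa²Σd
                          + n * n * n * n - + 3 * (n * n) * Σa² + + 3 * n * Σa³ - Σa⁴
Σd³-joinAll zero    ns Vs = refl
Σd³-joinAll (suc r) ns Vs = trans (Σd³-join G H) (close (Σd-joinAll r _ _) (Σd²-joinAll r _ _) (Σd³-joinAll r _ _))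
  where
    open FirstPart ns Vs
    close : ∀ {X₁ X₂ X₃} → X₁ ≡ Rest.ΣΣd + q * q - Rest.Σa²
      → X₂ ≡ Rest.ΣΣd² + + 2 * q * Rest.ΣΣd - + 2 * Rest.ΣaΣd + q * q * q - + 2 * q * Rest.Σa² + Rest.Σa³
      → X₃ ≡ Rest.ΣΣd³ + + 3 * q * Rest.ΣΣd² - + 3 * Rest.ΣaΣd² + + 3 * (q * q) * Rest.ΣΣd - + 6 * q * Rest.ΣaΣd
             + + 3 * Rest.Σa²Σd + q * q * q * q - + 3 * (q * q) * Rest.Σa² + + 3 * q * Rest.Σa³ - Rest.Σa⁴
      → (Σd³ G + + 3 * q * Σd² G + + 3 * (q * q) * Σd G + p * (q * q * q)) + (X₃ + + 3 * p * X₂ + + 3 * (p * p) * X₁ + q * (p * p * p))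
        ≡ All.ΣΣd³ + + 3 * All.n * All.ΣΣd² - + 3 * All.ΣaΣd² + + 3 * (All.n * All.n) * All.ΣΣd - + 6 * All.n * All.ΣaΣd
          + + 3 * All.Σa²Σd + All.n * All.n * All.n * All.n - + 3 * (All.n * All.n) * All.Σa² + + 3 * All.n * All.Σa³ - All.Σa⁴
    close refl refl refl = identity p q (Σd G) (Σd² G) (Σd³ G) Rest.ΣΣd Rest.ΣaΣd Rest.Σa²Σd Rest.ΣΣd² Rest.ΣaΣd² Rest.ΣΣd³
                                    Rest.Σa² Rest.Σa³ Rest.Σa⁴
      where
        identity : ∀ p q s₁ s₂ s₃ Q₀ Q₁ Q₂ R₀ R₁ T₀ P₂ P₃ P₄ →
          (s₃ + + 3 * q * s₂ + + 3 * (q * q) * s₁ + p * (q * q * q))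
          + ((T₀ + + 3 * q * R₀ - + 3 * R₁ + + 3 * (q * q) * Q₀ - + 6 * q * Q₁ + + 3 * Q₂
                + q * q * q * q - + 3 * (q * q) * P₂ + + 3 * q * P₃ - P₄)
             + + 3 * p * (R₀ + + 2 * q * Q₀ - + 2 * Q₁ + q * q * q - + 2 * q * P₂ + P₃)
             + + 3 * (p * p) * (Q₀ + q * q - P₂) + q * (p * p * p))
          ≡ (s₃ + T₀) + + 3 * (p + q) * (s₂ + R₀) - + 3 * (p * s₂ + R₁) + + 3 * ((p + q) * (p + q)) * (s₁ + Q₀)
            - + 6 * (p + q) * (p * s₁ + Q₁) + + 3 * (p * p * s₁ + Q₂)
            + (p + q) * (p + q) * (p + q) * (p + q) - + 3 * ((p + q) * (p + q)) * (p * p + P₂)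
            + + 3 * (p + q) * (p * p * p + P₃) - (p * p * p * p + P₄)
        identity = solve-∀

-- Acyclic parts have no closed walks of length 2 or 3 of their own.
trA²-joinAll : ∀ r ns Vs → (∀ i → Acyclic (Vs i)) → let open PartSums r ns Vs in trA² (joinAll r ns Vs) ≡ n * n - Σa²
trA²-joinAll zero    ns Vs acyclic = refl
trA²-joinAll (suc r) ns Vs acyclic =
  trans (trA²-join G H) (close (acyclic⇒trA² G (acyclic zero)) (trA²-joinAll r _ _ (λ i → acyclic (suc i))))
  where
    open FirstPart ns Vs
    close : ∀ {Y X} → Y ≡ + 0 → X ≡ q * q - Rest.Σa² → (Y + p * q) + (X + q * p) ≡ All.n * All.n - All.Σa²
    close refl refl = identity p q Rest.Σa²
      where
        identity : ∀ p q P₂ → (+ 0 + p * q) + ((q * q - P₂) + q * p) ≡ (p + q) * (p + q) - (p * p + P₂)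
        identity = solve-∀

trDA²-joinAll : ∀ r ns Vs → (∀ i → Acyclic (Vs i)) → let open PartSums r ns Vs in
  trDA² (joinAll r ns Vs) ≡ n * ΣΣd - ΣaΣd + n * n * n - + 2 * n * Σa² + Σa³
trDA²-joinAll zero    ns Vs acyclic = refl
trDA²-joinAll (suc r) ns Vs acyclic =
  trans (trDA²-join G H) (close (acyclic⇒trDA² G (acyclic zero)) (acyclic⇒trA² G (acyclic zero)) (Σd-joinAll r _ _)
                                (trA²-joinAll r _ _ (λ i → acyclic (suc i))) (trDA²-joinAll r _ _ (λ i → acyclic (suc i))))
  where
    open FirstPart ns Vs
    close : ∀ {Y₁ Y₂ X₁ X₂ X₃} → Y₁ ≡ + 0 → Y₂ ≡ + 0 → X₁ ≡ Rest.ΣΣd + q * q - Rest.Σa² → X₂ ≡ q * q - Rest.Σa²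
      → X₃ ≡ q * Rest.ΣΣd - Rest.ΣaΣd + q * q * q - + 2 * q * Rest.Σa² + Rest.Σa³
      → (Y₁ + q * Σd G + q * Y₂ + p * (q * q)) + (X₃ + p * X₁ + p * X₂ + q * (p * p))
        ≡ All.n * All.ΣΣd - All.ΣaΣd + All.n * All.n * All.n - + 2 * All.n * All.Σa² + All.Σa³
    close refl refl refl refl refl = identity p q (Σd G) Rest.ΣΣd Rest.ΣaΣd Rest.Σa² Rest.Σa³
      where
        identity : ∀ p q s₁ Q₀ Q₁ P₂ P₃ →
          (+ 0 + q * s₁ + q * + 0 + p * (q * q))
          + ((q * Q₀ - Q₁ + q * q * q - + 2 * q * P₂ + P₃) + p * (Q₀ + q * q - P₂) + p * (q * q - P₂) + q * (p * p))
          ≡ (p + q) * (s₁ + Q₀) - (p * s₁ + Q₁) + (p + q) * (p + q) * (p + q) - + 2 * (p + q) * (p * p + P₂) + (p * p * p + P₃)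
        identity = solve-∀

trA³-joinAll : ∀ r ns Vs → (∀ i → Acyclic (Vs i)) → let open PartSums r ns Vs in
  trA³ (joinAll r ns Vs) ≡ + 3 * (n * ΣΣd - ΣaΣd) + n * n * n - + 3 * n * Σa² + + 2 * Σa³
trA³-joinAll zero    ns Vs acyclic = refl
trA³-joinAll (suc r) ns Vs acyclic =
  trans (trA³-join G H) (close (acyclic⇒trA³ G (acyclic zero)) (Σd-joinAll r _ _) (trA³-joinAll r _ _ (λ i → acyclic (suc i))))
  where
    open FirstPart ns Vs
    close : ∀ {Y X₁ X₂} → Y ≡ + 0 → X₁ ≡ Rest.ΣΣd + q * q - Rest.Σa²
      → X₂ ≡ + 3 * (q * Rest.ΣΣd - Rest.ΣaΣd) + q * q * q - + 3 * q * Rest.Σa² + + 2 * Rest.Σa³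
      → (Y + q * Σd G + q * Σd G + p * X₁) + (X₂ + p * X₁ + p * X₁ + q * Σd G)
        ≡ + 3 * (All.n * All.ΣΣd - All.ΣaΣd) + All.n * All.n * All.n - + 3 * All.n * All.Σa² + + 2 * All.Σa³
    close refl refl refl = identity p q (Σd G) Rest.ΣΣd Rest.ΣaΣd Rest.Σa² Rest.Σa³
      where
        identity : ∀ p q s₁ Q₀ Q₁ P₂ P₃ →
          (+ 0 + q * s₁ + q * s₁ + p * (Q₀ + q * q - P₂))
          + ((+ 3 * (q * Q₀ - Q₁) + q * q * q - + 3 * q * P₂ + + 2 * P₃) + p * (Q₀ + q * q - P₂) + p * (Q₀ + q * q - P₂) + q * s₁)
          ≡ + 3 * ((p + q) * (s₁ + Q₀) - (p * s₁ + Q₁)) + (p + q) * (p + q) * (p + q) - + 3 * (p + q) * (p * p + P₂)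
            + + 2 * (p * p * p + P₃)
        identity = solve-∀

[]≡+[]ℕ : ∀ b → [ b ] ≡ + [ b ]ℕ
[]≡+[]ℕ true  = refl
[]≡+[]ℕ false = refl

outdeg≡+outdegℕ : ∀ {m} (G : Digraph m) v → outdeg G v ≡ + outdegℕ G v
outdeg≡+outdegℕ {m} G v = trans (sumFin-cong m (λ u → []≡+[]ℕ (G v u))) (sumFin-pos m (λ u → [ G v u ]ℕ))

+-shiftedCube : ∀ N d → + shiftedCube N d ≡ shiftedCubeℤ (+ N) (+ d)
+-shiftedCube N d = cong₂ _+_ (cong₂ _+_ cubic quadratic) linear
  where
    cubic : + (d ℕ.* d ℕ.* d) ≡ + d * + d * + d
    cubic = trans (ℤ.pos-* (d ℕ.* d) d) (cong (_* + d) (ℤ.pos-* d d))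
    quadratic : + (3 ℕ.* N ℕ.* (d ℕ.* d)) ≡ + 3 * + N * (+ d * + d)
    quadratic = trans (ℤ.pos-* (3 ℕ.* N) (d ℕ.* d)) (cong₂ _*_ (ℤ.pos-* 3 N) (ℤ.pos-* d d))
    linear : + (3 ℕ.* (N ℕ.* N) ℕ.* d) ≡ + 3 * (+ N * + N) * + d
    linear = trans (ℤ.pos-* (3 ℕ.* (N ℕ.* N)) d) (cong (_* + d) (trans (ℤ.pos-* 3 (N ℕ.* N)) (cong (+ 3 *_) (ℤ.pos-* N N))))

sum-shiftedCube-outdeg : ∀ {m} (G : Digraph m) N →
  + sum (λ v → shiftedCube N (outdegℕ G v)) ≡ Σd³ G + + 3 * + N * Σd² G + + 3 * (+ N * + N) * Σd G
sum-shiftedCube-outdeg {m} G N = begin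
  + sum (λ v → shiftedCube N (D v))
    ≡⟨ sumFin-pos m (λ v → shiftedCube N (D v)) ⟨
  sumFin m (λ v → + shiftedCube N (D v))
    ≡⟨ sumFin-cong m (λ v → trans (+-shiftedCube N (D v)) (cong (λ d → d * d * d + + 3 * + N * (d * d) + + 3 * (+ N * + N) * d)
                                                                (sym (outdeg≡+outdegℕ G v)))) ⟩
  sumFin m (λ v → outdeg G v * outdeg G v * outdeg G v + + 3 * + N * (outdeg G v * outdeg G v) + + 3 * (+ N * + N) * outdeg G v)
    ≡⟨ trans (sumFin-cong m (λ v → sym (ℤ.+-identityʳ _)))
             (trans (sumFin-combination m (λ v → outdeg G v * outdeg G v * outdeg G v) (λ v → outdeg G v * outdeg G v)
                                          (outdeg G) (+ 3 * + N) (+ 3 * (+ N * + N)) (+ 0))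
                    (dropZero _ (+ m))) ⟩
  Σd³ G + + 3 * + N * Σd² G + + 3 * (+ N * + N) * Σd G ∎
  where
    open ≡-Reasoning
    D : Fin m → ℕ
    D = outdegℕ G
    dropZero : ∀ x M → x + M * + 0 ≡ x
    dropZero = solve-∀

+-sumBelow-shiftedCube : ∀ N m → + 4 * + sumBelow m (shiftedCube N) ≡ sumBelowShiftedCube×4 (+ m) (+ N)
+-sumBelow-shiftedCube N zero    = at0 (+ N)
  where
    at0 : ∀ N → + 4 * + 0 ≡ + 0 * + 0 * (+ 0 - + 1) * (+ 0 - + 1) + + 2 * N * (+ 0 - + 1) * + 0 * (+ 2 * + 0 - + 1)
                             + + 6 * (N * N) * + 0 * (+ 0 - + 1)
    at0 = solve-∀
+-sumBelow-shiftedCube N (suc m) = begin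
  + 4 * + sumBelow (suc m) (shiftedCube N)
    ≡⟨ cong (λ z → + 4 * z) (trans (cong +_ (sumBelow-last m (shiftedCube N)))
                                   (ℤ.pos-+ (sumBelow m (shiftedCube N)) (shiftedCube N m))) ⟩
  + 4 * (+ sumBelow m (shiftedCube N) + + shiftedCube N m)
    ≡⟨ ℤ.*-distribˡ-+ (+ 4) (+ sumBelow m (shiftedCube N)) (+ shiftedCube N m) ⟩
  + 4 * + sumBelow m (shiftedCube N) + + 4 * + shiftedCube N m
    ≡⟨ cong₂ (λ x y → x + + 4 * y) (+-sumBelow-shiftedCube N m) (+-shiftedCube N m) ⟩
  sumBelowShiftedCube×4 (+ m) (+ N) + + 4 * shiftedCubeℤ (+ N) (+ m)
    ≡⟨ next-term (+ m) (+ N) ⟩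
  sumBelowShiftedCube×4 (+ suc m) (+ N) ∎
  where
    open ≡-Reasoning
    next-term : ∀ x N → x * x * (x - + 1) * (x - + 1) + + 2 * N * (x - + 1) * x * (+ 2 * x - + 1) + + 6 * (N * N) * x * (x - + 1)
                   + + 4 * (x * x * x + + 3 * N * (x * x) + + 3 * (N * N) * x)
                   ≡ (+ 1 + x) * (+ 1 + x) * ((+ 1 + x) - + 1) * ((+ 1 + x) - + 1)
                     + + 2 * N * ((+ 1 + x) - + 1) * (+ 1 + x) * (+ 2 * (+ 1 + x) - + 1) + + 6 * (N * N) * (+ 1 + x) * ((+ 1 + x) - + 1)
    next-term = solve-∀

loopless-joinAll : ∀ r ns (Vs : (i : Fin r) → Digraph (ns i)) → (∀ i → Loopless (Vs i)) → Loopless (joinAll r ns Vs)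
loopless-joinAll zero    ns Vs loopless ()
loopless-joinAll (suc r) ns Vs loopless = loopless-join (Vs zero) (joinAll r (λ i → ns (suc i)) (λ i → Vs (suc i)))
  (loopless zero) (loopless-joinAll r (λ i → ns (suc i)) (λ i → Vs (suc i)) (λ i → loopless (suc i)))

sumFin-expand-parts : ∀ r (a s₁ s₂ s₃ : Fin r → ℤ) n →
  sumFin r (λ i → s₃ i + + 3 * (n - a i) * s₂ i + + 3 * ((n - a i) * (n - a i)) * s₁ i)
  ≡ sumFin r s₃ + + 3 * n * sumFin r s₂ - + 3 * sumFin r (λ i → a i * s₂ i)
    + + 3 * (n * n) * sumFin r s₁ - + 6 * n * sumFin r (λ i → a i * s₁ i) + + 3 * sumFin r (λ i → a i * a i * s₁ i)
sumFin-expand-parts zero    a s₁ s₂ s₃ n = empty n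
  where
    empty : ∀ n → + 0 ≡ + 0 + + 3 * n * + 0 - + 3 * + 0 + + 3 * (n * n) * + 0 - + 6 * n * + 0 + + 3 * + 0
    empty = solve-∀
sumFin-expand-parts (suc r) a s₁ s₂ s₃ n =
  trans (cong (_+_ (s₃ zero + + 3 * (n - a zero) * s₂ zero + + 3 * ((n - a zero) * (n - a zero)) * s₁ zero))
              (sumFin-expand-parts r (λ i → a (suc i)) (λ i → s₁ (suc i)) (λ i → s₂ (suc i)) (λ i → s₃ (suc i)) n))
        (collect (a zero) (s₁ zero) (s₂ zero) (s₃ zero) n _ _ _ _ _ _)
  where
    collect : ∀ x t₁ t₂ t₃ n A B C D E F →
      t₃ + + 3 * (n - x) * t₂ + + 3 * ((n - x) * (n - x)) * t₁
      + (A + + 3 * n * B - + 3 * C + + 3 * (n * n) * D - + 6 * n * E + + 3 * F)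
      ≡ (t₃ + A) + + 3 * n * (t₂ + B) - + 3 * (x * t₂ + C) + + 3 * (n * n) * (t₁ + D)
        - + 6 * n * (x * t₁ + E) + + 3 * (x * x * t₁ + F)
    collect = solve-∀

-- The arcs inside the parts enter 3 Σ_v d_v c_v and tr A³ through the same term
-- 3 Σᵢ Nᵢ |A(Vⁱ)|, which therefore cancels.
LSM3-joinAll : ∀ r ns (Vs : (i : Fin r) → Digraph (ns i)) → (∀ i → Loopless (Vs i)) → (∀ i → Acyclic (Vs i)) →
  LSM3 (joinAll r ns Vs)
  ≡ sumFin r (λ i → + sum (λ v → shiftedCube (total r ns ∸ ns i) (outdegℕ (Vs i) v))) + PowerSums.multipartiteLSM3 r ns
LSM3-joinAll r ns Vs loopless acyclic = begin
  LSM3 (joinAll r ns Vs)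
    ≡⟨ LSM3≡stats (joinAll r ns Vs) (loopless-joinAll r ns Vs loopless) ⟩
  Σd³ (joinAll r ns Vs) + + 3 * trDA² (joinAll r ns Vs) - trA³ (joinAll r ns Vs)
    ≡⟨ cong₂ _-_ (cong₂ (λ x y → x + + 3 * y) (Σd³-joinAll r ns Vs) (trDA²-joinAll r ns Vs acyclic))
                 (trA³-joinAll r ns Vs acyclic) ⟩
  (ΣΣd³ + + 3 * n * ΣΣd² - + 3 * ΣaΣd² + + 3 * (n * n) * ΣΣd - + 6 * n * ΣaΣd + + 3 * Σa²Σd
    + n * n * n * n - + 3 * (n * n) * Σa² + + 3 * n * Σa³ - Σa⁴)
    + + 3 * (n * ΣΣd - ΣaΣd + n * n * n - + 2 * n * Σa² + Σa³)
    - (+ 3 * (n * ΣΣd - ΣaΣd) + n * n * n - + 3 * n * Σa² + + 2 * Σa³)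
    ≡⟨ regroup n ΣΣd ΣaΣd Σa²Σd ΣΣd² ΣaΣd² ΣΣd³ Σa² Σa³ Σa⁴ ⟩
  (ΣΣd³ + + 3 * n * ΣΣd² - + 3 * ΣaΣd² + + 3 * (n * n) * ΣΣd - + 6 * n * ΣaΣd + + 3 * Σa²Σd) + multipartiteLSM3
    ≡⟨ cong (_+ multipartiteLSM3) (sumFin-expand-parts r a (λ i → Σd (Vs i)) (λ i → Σd² (Vs i)) (λ i → Σd³ (Vs i)) n) ⟨
  sumFin r (λ i → Σd³ (Vs i) + + 3 * (n - a i) * Σd² (Vs i) + + 3 * ((n - a i) * (n - a i)) * Σd (Vs i)) + multipartiteLSM3
    ≡⟨ cong (_+ multipartiteLSM3) (sumFin-cong r part) ⟩
  sumFin r (λ i → + sum (λ v → shiftedCube (total r ns ∸ ns i) (outdegℕ (Vs i) v))) + multipartiteLSM3 ∎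
  where
    open ≡-Reasoning
    open PartSums r ns Vs
    part : ∀ i → Σd³ (Vs i) + + 3 * (n - a i) * Σd² (Vs i) + + 3 * ((n - a i) * (n - a i)) * Σd (Vs i)
                 ≡ + sum (λ v → shiftedCube (total r ns ∸ ns i) (outdegℕ (Vs i) v))
    part i = sym (trans (sum-shiftedCube-outdeg (Vs i) (total r ns ∸ ns i))
      (cong (λ N → Σd³ (Vs i) + + 3 * N * Σd² (Vs i) + + 3 * (N * N) * Σd (Vs i)) (+-∸ (part≤total r ns i))))
    regroup : ∀ n Q₀ Q₁ Q₂ R₀ R₁ T₀ P₂ P₃ P₄ →
      (T₀ + + 3 * n * R₀ - + 3 * R₁ + + 3 * (n * n) * Q₀ - + 6 * n * Q₁ + + 3 * Q₂
        + n * n * n * n - + 3 * (n * n) * P₂ + + 3 * n * P₃ - P₄)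
        + + 3 * (n * Q₀ - Q₁ + n * n * n - + 2 * n * P₂ + P₃)
        - (+ 3 * (n * Q₀ - Q₁) + n * n * n - + 3 * n * P₂ + + 2 * P₃)
      ≡ (T₀ + + 3 * n * R₀ - + 3 * R₁ + + 3 * (n * n) * Q₀ - + 6 * n * Q₁ + + 3 * Q₂)
        + (n * n * n * n + + 2 * (n * n * n) - + 3 * (n * n) * P₂ - + 3 * n * P₂ + + 3 * n * P₃ + P₃ - P₄)
    regroup = solve-∀

+-cancelʳ-≡ : ∀ {x y} c → x + c ≡ y + c → x ≡ y
+-cancelʳ-≡ {x} {y} c eq = trans (add-sub x c) (trans (cong (_- c) eq) (sym (add-sub y c)))
  where
    add-sub : ∀ x c → x ≡ x + c - c
    add-sub = solve-∀

compare-sums : ∀ {r} {x y : Fin r → ℕ} {P : Fin r → Set} {lo hi} c →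
  lo ≡ + sum x + c → hi ≡ + sum y + c → (∀ i → x i ≤ y i) → (∀ i → x i ≡ y i ⇔ P i) →
  lo Z.≤ hi × (lo ≡ hi ⇔ (∀ i → P i))
compare-sums {x = x} {y} c refl refl x≤y x≡y⇔P =
  ℤ.+-monoˡ-≤ c (Z.+≤+ (sum-mono x≤y))
  , mk⇔ (λ eq i → Equivalence.to (x≡y⇔P i) (sum-mono-≡ x≤y (ℤ.+-injective (+-cancelʳ-≡ c eq)) i))
        (λ all-P → cong (λ s → + s + c) (sum-cong-≗ (λ i → Equivalence.from (x≡y⇔P i) (all-P i))))

module _ {m : ℕ} (G : Digraph m) where
  outdeg≤1⇔InTree : WeaklyConnected G → Acyclic G → (∀ v → outdegℕ G v ≤ 1) ⇔ InTree G
  outdeg≤1⇔InTree connected acyclic = mk⇔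
    (λ outdeg≤1 → (connected , acyclic-outdeg≤1⇒¬HasUCycle G acyclic outdeg≤1)
                  , (λ v → subst (Z._≤ + 1) (sym (outdeg≡+outdegℕ G v)) (Z.+≤+ (outdeg≤1 v))))
    (λ in-tree v → ℤ.drop‿+≤+ (subst (Z._≤ + 1) (outdeg≡+outdegℕ G v) (proj₂ in-tree v)))

module _ (r : ℕ) (ns : Fin r → ℕ) where
  open PowerSums r ns

  outside : Fin r → ℕ
  outside i = total r ns ∸ ns i

  private
    +outside : ∀ i → + outside i ≡ n - a i
    +outside i = +-∸ (part≤total r ns i)

  lowerBound≡sum : (∀ i → 1 ≤ ns i) →
    lowerBound r ns ≡ + sum (λ i → (ns i ∸ 1) ℕ.* shiftedCube (outside i) 1) + multipartiteLSM3
  lowerBound≡sum ns≥1 = trans lowerBound≡ (cong (_+ multipartiteLSM3) (trans (sumFin-cong r part) (sumFin-pos r _)))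
    where
      part : ∀ i → (a i - + 1) * shiftedCubeℤ (n - a i) (+ 1) ≡ + ((ns i ∸ 1) ℕ.* shiftedCube (outside i) 1)
      part i = sym (trans (ℤ.pos-* (ns i ∸ 1) (shiftedCube (outside i) 1))
                          (cong₂ _*_ (+-∸ (ns≥1 i)) (trans (+-shiftedCube (outside i) 1) (cong (λ N → shiftedCubeℤ N (+ 1)) (+outside i)))))

  upperBound×4≡sum : upperBound×4 r ns ≡ + sum (λ i → 4 ℕ.* sumBelow (ns i) (shiftedCube (outside i))) + + 4 * multipartiteLSM3
  upperBound×4≡sum = trans upperBound×4≡ (cong (_+ + 4 * multipartiteLSM3) (trans (sumFin-cong r part) (sumFin-pos r _)))
    where
      part : ∀ i → sumBelowShiftedCube×4 (a i) (n - a i) ≡ + (4 ℕ.* sumBelow (ns i) (shiftedCube (outside i)))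
      part i = sym (trans (ℤ.pos-* 4 (sumBelow (ns i) (shiftedCube (outside i))))
                          (trans (+-sumBelow-shiftedCube (outside i) (ns i)) (cong (sumBelowShiftedCube×4 (a i)) (+outside i))))

  module _ (Vs : (i : Fin r) → Digraph (ns i)) (loopless : ∀ i → Loopless (Vs i)) (acyclic : ∀ i → Acyclic (Vs i)) where
    shiftedCubeSum : Fin r → ℕ
    shiftedCubeSum i = sum (λ v → shiftedCube (outside i) (outdegℕ (Vs i) v))

    LSM3≡sum : LSM3 (joinAll r ns Vs) ≡ + sum shiftedCubeSum + multipartiteLSM3
    LSM3≡sum = trans (LSM3-joinAll r ns Vs loopless acyclic) (cong (_+ multipartiteLSM3) (sumFin-pos r shiftedCubeSum))

    4·LSM3≡sum : + 4 * LSM3 (joinAll r ns Vs) ≡ + sum (λ i → 4 ℕ.* shiftedCubeSum i) + + 4 * multipartiteLSM3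
    4·LSM3≡sum = trans (cong (+ 4 *_) LSM3≡sum)
      (trans (ℤ.*-distribˡ-+ (+ 4) (+ sum shiftedCubeSum) multipartiteLSM3)
             (cong (_+ + 4 * multipartiteLSM3) (trans (sym (ℤ.pos-* 4 (sum shiftedCubeSum))) (cong +_ (*-distribˡ-sum 4 shiftedCubeSum)))))

    in-tree-bounds : (∀ i → 1 ≤ ns i) → (∀ i → WeaklyConnected (Vs i)) →
      lowerBound r ns Z.≤ LSM3 (joinAll r ns Vs) × (LSM3 (joinAll r ns Vs) ≡ lowerBound r ns ⇔ (∀ i → InTree (Vs i)))
    in-tree-bounds ns≥1 connected = proj₁ comparison , proj₂ comparison ⇔-∘ mk⇔ sym sym
      where
        bounds : ∀ i → (ns i ∸ 1) ℕ.* shiftedCube (outside i) 1 ≤ shiftedCubeSum i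
                       × ((ns i ∸ 1) ℕ.* shiftedCube (outside i) 1 ≡ shiftedCubeSum i ⇔ (∀ v → outdegℕ (Vs i) v ≤ 1))
        bounds i = in-tree-bound (Vs i) (connected i) (acyclic i) (fromℕ< (ns≥1 i)) (outside i)
        comparison : lowerBound r ns Z.≤ LSM3 (joinAll r ns Vs)
                     × (lowerBound r ns ≡ LSM3 (joinAll r ns Vs) ⇔ (∀ i → InTree (Vs i)))
        comparison = compare-sums multipartiteLSM3 (lowerBound≡sum ns≥1) LSM3≡sum (λ i → proj₁ (bounds i))
                       (λ i → outdeg≤1⇔InTree (Vs i) (connected i) (acyclic i) ⇔-∘ proj₂ (bounds i))

    tournament-bounds :
      + 4 * LSM3 (joinAll r ns Vs) Z.≤ upperBound×4 r ns
      × (+ 4 * LSM3 (joinAll r ns Vs) ≡ upperBound×4 r ns ⇔ (∀ i → TransitiveTournament (Vs i)))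
    tournament-bounds = compare-sums (+ 4 * multipartiteLSM3) 4·LSM3≡sum upperBound×4≡sum
      (λ i → ℕ.*-monoʳ-≤ 4 (proj₁ (bounds i)))
      (λ i → proj₂ (bounds i) ⇔-∘ mk⇔ (ℕ.*-cancelˡ-≡ _ _ 4) (cong (4 ℕ.*_)))
      where
        bounds : ∀ i → shiftedCubeSum i ≤ sumBelow (ns i) (shiftedCube (outside i))
                       × (shiftedCubeSum i ≡ sumBelow (ns i) (shiftedCube (outside i)) ⇔ TransitiveTournament (Vs i))
        bounds i = tournament-bound (Vs i) (acyclic i) (outside i)

theorem3p3 : (r : ℕ) → 1 ≤ r →
    (ns : Fin r → ℕ) → ((i : Fin r) → 1 ≤ ns i) →
    ((i j : Fin r) → i F.≤ j → ns j ≤ ns i) →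
    (Vs : (i : Fin r) → Digraph (ns i)) →
    ((i : Fin r) → Loopless (Vs i)) →
    ((i : Fin r) → WeaklyConnected (Vs i)) →
    ((i : Fin r) → Acyclic (Vs i)) →
    ((lowerBound r ns Z.≤ LSM3 (joinAll r ns Vs))
    × ((LSM3 (joinAll r ns Vs) ≡ lowerBound r ns) ⇔ ((i : Fin r) → InTree (Vs i))))
    × ((+ 4 * LSM3 (joinAll r ns Vs) Z.≤ upperBound×4 r ns)
    × ((+ 4 * LSM3 (joinAll r ns Vs) ≡ upperBound×4 r ns)
    ⇔ ((i : Fin r) → TransitiveTournament (Vs i))))
theorem3p3 r _ ns ns≥1 _ Vs loopless connected acyclic =
  in-tree-bounds r ns Vs loopless acyclic ns≥1 connected , tournament-bounds r ns Vs loopless acyclic
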